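{- For any linear genome $G$, $pdcj(G)\le \frac{3\,b(G)}{2}$.
   Context: A (unsigned) genome is a collection of vertex-disjoint paths and cycles (multigraph; loops and parallel edges allowed) over $\{0,1,\ldots,n+1\}$; it is linear if it is a single path with endpoints $0$ and $n+1$. The identity genome is the path $0,1,\ldots,n+1$. A DCJ takes two distinct edges $e=\{u,v\}$, $f=\{w,x\}$ and replaces them by either $\{u,w\},\{v,x\}$ or $\{u,x\},\{v,w\}$; it is a prefix DCJ if $0\in e$ or $0\in f$. $pdcj(G)$ is the minimum number of prefix DCJs transforming $G$ into the identity genome. An edge $\{u,v\}$ is a breakpoint if $0\notin\{u,v\}$ and either $|u-v|\ne1$ or the edge has multiplicity two; $b(G)$ is the number of breakpoints. -}

module Defs where

open import Data.Nat using (ℕ; zero; suc; _≤ᵇ_; ∣_-_∣; _≡ᵇ_)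
open import Data.Nat.Base using (_<ᵇ_)
open import Data.Fin using (Fin; toℕ; inject₁; fromℕ) renaming (zero to fzero; suc to fsuc)
open import Data.Bool using (Bool; true; false; if_then_else_; _∧_; _∨_; not)
open import Data.Product using (_×_; _,_; ∃-syntax; Σ-syntax)
open import Data.Sum using (_⊎_)
open import Data.List using (List; []; _∷_; map; length; allFin)
open import Data.List.Relation.Binary.Permutation.Propositional using (_↭_)
open import Relation.Binary.PropositionalEquality using (_≡_)
open import Function.Definitions using (Injective)

Vertex : ℕ → Set
Vertex n = Fin (suc (suc n))

-- An (unordered) edge {u,v} is stored as a pair; orientation is irrelevant
-- (all comparisons go through `norm`).
Edge : ℕ → Set
Edge n = Vertex n × Vertex n

-- A genome (multigraph, loops and parallel edges allowed) as a multiset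
-- (list) of edges.
Genome : ℕ → Set
Genome n = List (Edge n)

norm : ∀ {n} → Edge n → Edge n
norm (u , v) = if toℕ u ≤ᵇ toℕ v then (u , v) else (v , u)

_≅_ : ∀ {n} → Genome n → Genome n → Set
G ≅ H = map norm G ↭ map norm H

v0 : ∀ {n} → Vertex n
v0 = fzero

vLast : ∀ {n} → Vertex n
vLast {n} = fromℕ (suc n)

identity : (n : ℕ) → Genome n
identity n = map (λ (i : Fin (suc n)) → (inject₁ i , fsuc i)) (allFin (suc n))

IsLinear : ∀ {n} → Genome n → Set
IsLinear {n} G =
  Σ[ f ∈ (Vertex n → Vertex n) ]
    (Injective _≡_ _≡_ f × f fzero ≡ v0 × f (fromℕ (suc n)) ≡ vLast ×
     G ≅ map (λ (i : Fin (suc n)) → (f (inject₁ i) , f (fsuc i))) (allFin (suc n)))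

-- One prefix DCJ step: two distinct edges (two distinct list occurrences)
-- e = {u,v}, f = {w,x}, with 0 ∈ e or 0 ∈ f, are replaced by
-- {u,w},{v,x} or by {u,x},{v,w}.
PrefixDCJ : ∀ {n} → Genome n → Genome n → Set
PrefixDCJ {n} G H =
  ∃[ u ] ∃[ v ] ∃[ w ] ∃[ x ] ∃[ R ]
    (G ↭ ((u , v) ∷ (w , x) ∷ R)) ×
    (u ≡ v0 ⊎ v ≡ v0 ⊎ w ≡ v0 ⊎ x ≡ v0) ×
    (H ≡ (u , w) ∷ (v , x) ∷ R ⊎ H ≡ (u , x) ∷ (v , w) ∷ R)

data ReachesIdentity {n : ℕ} : ℕ → Genome n → Set where
  done : ∀ {G} → G ≅ identity n → ReachesIdentity zero G
  step : ∀ {k G H} → PrefixDCJ G H → ReachesIdentity k H → ReachesIdentity (suc k) G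

count : ∀ {A : Set} → (A → Bool) → List A → ℕ
count p [] = 0
count p (x ∷ xs) = if p x then suc (count p xs) else count p xs

sameEdge : ∀ {n} → Edge n → Edge n → Bool
sameEdge e f with norm e | norm f
... | (a , b) | (c , d) = (toℕ a ≡ᵇ toℕ c) ∧ (toℕ b ≡ᵇ toℕ d)

multiplicity : ∀ {n} → Genome n → Edge n → ℕ
multiplicity G e = count (sameEdge e) G

isBreakpoint : ∀ {n} → Genome n → Edge n → Bool
isBreakpoint G (u , v) =
  not (toℕ u ≡ᵇ 0) ∧ not (toℕ v ≡ᵇ 0) ∧
  (not (∣ toℕ u - toℕ v ∣ ≡ᵇ 1) ∨ (multiplicity G (u , v) ≡ᵇ 2))

b : ∀ {n} → Genome n → ℕ
b G = count (isBreakpoint G) G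

module Submission where

-- A genome is well formed if it has n + 1 edges, its ends 0 and n + 1 have degree 1 and every
-- other vertex has degree 2 (a path from 0 to n + 1 plus cycles); let missing(G) count the
-- adjacencies {i,i+1}, 1 ≤ i ≤ n, absent from G. By induction on missing(G), a well-formed G is
-- sorted by k prefix DCJs with 2k + [{0,1} ∉ G] ≤ 3·missing(G). Let {0,a} be the edge at 0.
-- If a ≥ 2, one of {a-1,a}, {a,a+1} is missing, and one DCJ joins a to that neighbour t while cutting
-- an edge at t that carries no adjacency or a duplicated one, so missing(G) drops. If a = 1, either G
-- is the identity, or the first missing adjacency {m,m+1} is created by one such DCJ (m = 1) or by two:
-- {0,1},{m,z} becomes {0,m},{1,z}, and then m is joined to m+1. The second genome lacks {0,1}, and
-- that credit pays for the extra DCJ. Finally missing(G) ≤ b(G): at least n edges avoid 0, and each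
-- of them is a breakpoint or the only copy of a present adjacency.

open import Defs
open import Data.Bool using (Bool; true; false; T; not; _∧_; _∨_)
open import Data.Empty using (⊥)
open import Data.Fin using (Fin; toℕ; inject₁; fromℕ; fromℕ<; lower₁; punchOut) renaming (zero to fzero; suc to fsuc)
import Data.Fin.Properties as Fin
open import Data.List using (List; []; _∷_; map; length; tabulate; applyUpTo; _++_)
open import Data.List.Membership.Propositional using (_∈_)
open import Data.List.Membership.Propositional.Properties using (∈-applyUpTo⁺; ∈-applyUpTo⁻)
open import Data.List.Properties
  using (∷-injective; length-map; length-applyUpTo; length-tabulate; length-++; ++-identityʳ; map-cong; map-∘; map-tabulate)
open import Data.List.Relation.Binary.Permutation.Propositional
  using (_↭_; ↭-refl; ↭-reflexive; ↭-trans; ↭-prep; ↭-swap)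
open import Data.List.Relation.Binary.Permutation.Propositional.Properties using (map⁺; ↭-map-inv; ↭-length; drop-∷)
open import Data.List.Relation.Unary.Any using (here; there)
open import Data.Nat
open import Data.Nat.Induction using (<-wellFounded)
open import Data.Nat.ListAction using (sum)
open import Data.Nat.ListAction.Properties using (sum-↭)
open import Data.Nat.Properties
open import Data.Nat.Tactic.RingSolver using (solve-∀)
open import Data.Product using (_×_; _,_; proj₁; proj₂; ∃-syntax; Σ-syntax; swap)
open import Data.Sum using (_⊎_; inj₁; inj₂)
open import Function using (_∘_)
open import Induction.WellFounded using (module All)
open import Level using (0ℓ)
import Relation.Binary.Construct.On as On
open import Relation.Binary.PropositionalEquality
open import Relation.Nullary using (¬_; Dec; yes; no; contradiction)

2+m≢m : ∀ m → suc (suc m) ≢ m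
2+m≢m (suc m) = 2+m≢m m ∘ suc-injective

¬1≤⇒≡0 : ∀ {x} → ¬ 1 ≤ x → x ≡ 0
¬1≤⇒≡0 ¬pos = n<1⇒n≡0 (≰⇒> ¬pos)

≢0∧≢1⇒≥2 : ∀ {x} → x ≢ 0 → x ≢ 1 → 2 ≤ x
≢0∧≢1⇒≥2 {zero}        x≢0 _   = contradiction refl x≢0
≢0∧≢1⇒≥2 {suc zero}    _   x≢1 = contradiction refl x≢1
≢0∧≢1⇒≥2 {suc (suc _)} _   _   = s≤s (s≤s z≤n)

≢0⇒≡ᵇ0 : ∀ {x} → x ≢ 0 → (x ≡ᵇ 0) ≡ false
≢0⇒≡ᵇ0 {zero}  x≢0 = contradiction refl x≢0
≢0⇒≡ᵇ0 {suc _} _   = refl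

≡ᵇ-refl : ∀ x → (x ≡ᵇ x) ≡ true
≡ᵇ-refl zero    = refl
≡ᵇ-refl (suc x) = ≡ᵇ-refl x

≡ᵇ-sound : ∀ x y → (x ≡ᵇ y) ≡ true → x ≡ y
≡ᵇ-sound x y eq = ≡ᵇ⇒≡ x y (subst T (sym eq) _)

∧-true : ∀ {x y : Bool} → (x ∧ y) ≡ true → x ≡ true × y ≡ true
∧-true {true} {true} _ = refl , refl

∣-∣≡1 : ∀ x y → ∣ x - y ∣ ≡ 1 → y ≡ suc x ⊎ x ≡ suc y
∣-∣≡1 zero    y       eq = inj₁ eq
∣-∣≡1 (suc x) zero    eq = inj₂ (cong suc (suc-injective eq))
∣-∣≡1 (suc x) (suc y) eq = Data.Sum.map (cong suc) (cong suc) (∣-∣≡1 x y eq)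

first-failure : ∀ (P : ℕ → Set) → (∀ i → Dec (P i)) → ∀ k →
                (∀ i → 1 ≤ i → i ≤ k → P i) ⊎ ∃[ m ] (1 ≤ m × m ≤ k × ¬ P m × (∀ i → 1 ≤ i → i < m → P i))
first-failure P P? zero    = inj₁ λ i 1≤i i≤0 → contradiction (≤-trans 1≤i i≤0) λ ()
first-failure P P? (suc k) with first-failure P P? k
... | inj₂ (m , 1≤m , m≤k , ¬Pm , below) = inj₂ (m , 1≤m , m≤n⇒m≤1+n m≤k , ¬Pm , below)
... | inj₁ upto-k with P? (suc k)
...   | no ¬P = inj₂ (suc k , s≤s z≤n , ≤-refl , ¬P , λ i 1≤i i≤k → upto-k i 1≤i (≤-pred i≤k))
...   | yes P1+k = inj₁ λ i 1≤i i≤1+k → case (m≤n⇒m<n∨m≡n i≤1+k) 1≤i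
  where
  case : ∀ {i} → i < suc k ⊎ i ≡ suc k → 1 ≤ i → P i
  case (inj₁ i<1+k) 1≤i = upto-k _ 1≤i (≤-pred i<1+k)
  case (inj₂ refl)  _   = P1+k

δ : ℕ → ℕ → ℕ
δ zero    zero    = 1
δ zero    (suc _) = 0
δ (suc _) zero    = 0
δ (suc x) (suc y) = δ x y

δ-refl : ∀ x → δ x x ≡ 1
δ-refl zero    = refl
δ-refl (suc x) = δ-refl x

δ-≢ : ∀ {x y} → x ≢ y → δ x y ≡ 0
δ-≢ {zero}  {zero}  x≢y = contradiction refl x≢y
δ-≢ {zero}  {suc y} _   = refl
δ-≢ {suc x} {zero}  _   = refl
δ-≢ {suc x} {suc y} x≢y = δ-≢ (x≢y ∘ cong suc)

δ-≡ : ∀ {x y} → 1 ≤ δ x y → x ≡ y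
δ-≡ {zero}  {zero}  _   = refl
δ-≡ {suc x} {suc y} pos = cong suc (δ-≡ pos)

δ≤1 : ∀ x y → δ x y ≤ 1
δ≤1 x y with x ≟ y
... | yes refl = ≤-reflexive (δ-refl x)
... | no x≢y   = subst (_≤ 1) (sym (δ-≢ x≢y)) z≤n

δ+δ≤1 : ∀ {d d′} x → d ≢ d′ → δ d x + δ d′ x ≤ 1
δ+δ≤1 {d} {d′} x d≢d′ with d ≟ x
... | yes refl rewrite δ-refl d | δ-≢ (d≢d′ ∘ sym) = ≤-refl
... | no d≢x   rewrite δ-≢ d≢x = δ≤1 d′ x

absent : ℕ → ℕ
absent zero    = 1
absent (suc _) = 0

absent≤1 : ∀ x → absent x ≤ 1
absent≤1 zero    = ≤-refl
absent≤1 (suc _) = z≤n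

absent-positive : ∀ {x} → 1 ≤ x → absent x ≡ 0
absent-positive (s≤s _) = refl

absent-anti : ∀ {x y} → (1 ≤ x → 1 ≤ y) → absent y ≤ absent x
absent-anti {zero}  {zero}  _   = ≤-refl
absent-anti {zero}  {suc _} _   = z≤n
absent-anti {suc x} {zero}  x→y = contradiction (x→y (s≤s z≤n)) λ ()
absent-anti {suc x} {suc _} _   = z≤n

absent-drop : ∀ {x y} → x ≡ 0 → 1 ≤ y → absent y < absent x
absent-drop refl (s≤s _) = s≤s z≤n

single : ℕ → ℕ
single 1 = 1
single _ = 0

single+absent≤1 : ∀ x → x * single x + absent x ≤ 1
single+absent≤1 zero          = ≤-refl
single+absent≤1 (suc zero)    = ≤-refl
single+absent≤1 (suc (suc x)) rewrite *-zeroʳ x = z≤n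

fromBool : Bool → ℕ
fromBool true  = 1
fromBool false = 0

∑ : {A : Set} → (A → ℕ) → List A → ℕ
∑ f xs = sum (map f xs)

module _ {A : Set} where

  ∑-↭ : ∀ (f : A → ℕ) {xs ys} → xs ↭ ys → ∑ f xs ≡ ∑ f ys
  ∑-↭ f p = sum-↭ (map⁺ f p)

  ∑-cong : ∀ {f g : A → ℕ} → (∀ x → f x ≡ g x) → ∀ xs → ∑ f xs ≡ ∑ g xs
  ∑-cong f≗g xs = cong sum (map-cong f≗g xs)

  ∑-map : ∀ {B : Set} (f : B → ℕ) (g : A → B) xs → ∑ f (map g xs) ≡ ∑ (f ∘ g) xs
  ∑-map f g xs = cong sum (sym (map-∘ xs))

  ∑-+ : ∀ (f g : A → ℕ) xs → ∑ (λ x → f x + g x) xs ≡ ∑ f xs + ∑ g xs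
  ∑-+ f g []       = refl
  ∑-+ f g (x ∷ xs) = begin
    f x + g x + ∑ (λ x → f x + g x) xs ≡⟨ cong (f x + g x +_) (∑-+ f g xs) ⟩
    f x + g x + (∑ f xs + ∑ g xs)      ≡⟨ +-exchange (f x) (g x) (∑ f xs) (∑ g xs) ⟩
    f x + ∑ f xs + (g x + ∑ g xs)      ∎
    where
    open ≡-Reasoning
    +-exchange : ∀ a b c d → a + b + (c + d) ≡ a + c + (b + d)
    +-exchange = solve-∀

  ∑-*ʳ : ∀ (f : A → ℕ) c xs → ∑ (λ x → f x * c) xs ≡ ∑ f xs * c
  ∑-*ʳ f c []       = refl
  ∑-*ʳ f c (x ∷ xs) = trans (cong (f x * c +_) (∑-*ʳ f c xs)) (sym (*-distribʳ-+ c (f x) (∑ f xs)))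

  ∑-const : ∀ (xs : List A) → ∑ (λ _ → 1) xs ≡ length xs
  ∑-const []       = refl
  ∑-const (x ∷ xs) = cong suc (∑-const xs)

  ∑-mono : ∀ {f g : A → ℕ} xs → (∀ x → x ∈ xs → f x ≤ g x) → ∑ f xs ≤ ∑ g xs
  ∑-mono []       f≤g = z≤n
  ∑-mono (x ∷ xs) f≤g = +-mono-≤ (f≤g x (here refl)) (∑-mono xs (λ y y∈ → f≤g y (there y∈)))

  ∑-mono-< : ∀ {f g : A → ℕ} xs → (∀ x → x ∈ xs → f x ≤ g x) → ∀ {y} → y ∈ xs → f y < g y → ∑ f xs < ∑ g xs
  ∑-mono-< (x ∷ xs) f≤g (here refl) fy<gy = +-mono-<-≤ fy<gy (∑-mono xs (λ y y∈ → f≤g y (there y∈)))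
  ∑-mono-< (x ∷ xs) f≤g (there y∈)  fy<gy =
    +-mono-≤-< (f≤g x (here refl)) (∑-mono-< xs (λ y y∈ → f≤g y (there y∈)) y∈ fy<gy)

  ∑-∈ : ∀ (f : A → ℕ) {x xs} → x ∈ xs → f x ≤ ∑ f xs
  ∑-∈ f (here refl)            = m≤m+n _ _
  ∑-∈ f {xs = y ∷ _} (there x∈) = ≤-trans (∑-∈ f x∈) (m≤n+m _ (f y))

  ∑-positive : ∀ (f : A → ℕ) xs → 1 ≤ ∑ f xs → ∃[ x ] ∃[ ys ] (xs ↭ x ∷ ys × 1 ≤ f x)
  ∑-positive f (x ∷ xs) pos with f x in fx
  ... | suc _ = x , xs , ↭-refl , subst (1 ≤_) (sym fx) (s≤s z≤n)
  ... | zero with ∑-positive f xs pos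
  ...   | y , ys , xs↭ , fy = y , x ∷ ys , ↭-trans (↭-prep x xs↭) (↭-swap x y ↭-refl) , fy

  ∑-tabulate-0 : ∀ {m} (w : A → ℕ) (h : Fin m → A) → (∀ l → w (h l) ≡ 0) → ∑ w (tabulate h) ≡ 0
  ∑-tabulate-0 {zero}  w h _  = refl
  ∑-tabulate-0 {suc m} w h w0 = cong₂ _+_ (w0 fzero) (∑-tabulate-0 w (h ∘ fsuc) (w0 ∘ fsuc))

  ∑-tabulate-1 : ∀ {m} (w : A → ℕ) (h : Fin m → A) j → w (h j) ≡ 1 → (∀ l → l ≢ j → w (h l) ≡ 0) →
                 ∑ w (tabulate h) ≡ 1
  ∑-tabulate-1 w h fzero    w1 w0 = cong₂ _+_ w1 (∑-tabulate-0 w (h ∘ fsuc) (λ l → w0 (fsuc l) λ ()))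
  ∑-tabulate-1 w h (fsuc j) w1 w0 =
    cong₂ _+_ (w0 fzero λ ()) (∑-tabulate-1 w (h ∘ fsuc) j w1 (λ l l≢j → w0 (fsuc l) (l≢j ∘ Fin.suc-injective)))

∑-comm : ∀ {A B : Set} (h : A → B → ℕ) xs ys →
         ∑ (λ x → ∑ (h x) ys) xs ≡ ∑ (λ y → ∑ (λ x → h x y) xs) ys
∑-comm h []       ys = sym (zeros ys)
  where
  zeros : ∀ ys → ∑ (λ _ → 0) ys ≡ 0
  zeros []       = refl
  zeros (_ ∷ ys) = zeros ys
∑-comm h (x ∷ xs) ys = begin
  ∑ (h x) ys + ∑ (λ x → ∑ (h x) ys) xs                 ≡⟨ cong (∑ (h x) ys +_) (∑-comm h xs ys) ⟩
  ∑ (h x) ys + ∑ (λ y → ∑ (λ x → h x y) xs) ys         ≡⟨ sym (∑-+ (h x) _ ys) ⟩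
  ∑ (λ y → h x y + ∑ (λ x → h x y) xs) ys              ∎
  where open ≡-Reasoning

count≡∑ : ∀ {A : Set} (p : A → Bool) xs → count p xs ≡ ∑ (fromBool ∘ p) xs
count≡∑ p []       = refl
count≡∑ p (x ∷ xs) with p x
... | true  = cong suc (count≡∑ p xs)
... | false = count≡∑ p xs

injective⇒surjective : ∀ {m} (f : Fin m → Fin m) → (∀ {i j} → f i ≡ f j → i ≡ j) → ∀ v → ∃[ j ] f j ≡ v
injective⇒surjective {zero}  f f-inj ()
injective⇒surjective {suc m} f f-inj v with Fin.any? (λ j → f j Fin.≟ v)
... | yes hit = hit
... | no  miss = contradiction (Fin.injective⇒≤ {f = squeeze} squeeze-injective) 1+n≰n
  where
  missed : ∀ j → v ≢ f j
  missed j v≡ = miss (j , sym v≡)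
  squeeze : Fin (suc m) → Fin m
  squeeze j = punchOut (missed j)
  squeeze-injective : ∀ {i j} → squeeze i ≡ squeeze j → i ≡ j
  squeeze-injective eq = f-inj (Fin.punchOut-injective (missed _) (missed _) eq)

-- Flank t s i: the adjacencies {t-1,t} and {t,t+1} at vertex t have indices s and i, in some order.
data Flank : ℕ → ℕ → ℕ → Set where
  lower : ∀ k → Flank (suc k) k (suc k)
  upper : ∀ k → Flank (suc k) (suc k) k

far : ∀ {t s i} → Flank t s i → ℕ
far (lower k) = k
far (upper k) = suc (suc k)

far≢ : ∀ {t s i} (F : Flank t s i) → far F ≢ t
far≢ (lower k) = 1+n≢n ∘ sym
far≢ (upper k) = 1+n≢n

flank-index : ∀ {t s i j} → Flank t s i → j ≡ t ⊎ suc j ≡ t → j ≡ s ⊎ j ≡ i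
flank-index (lower k) (inj₁ refl) = inj₂ refl
flank-index (lower k) (inj₂ refl) = inj₁ refl
flank-index (upper k) (inj₁ refl) = inj₁ refl
flank-index (upper k) (inj₂ refl) = inj₂ refl

flank-bounds : ∀ {t s i m} → Flank t s i → s ≤ m → 1 ≤ t × t ≤ suc m
flank-bounds (lower k) k≤m   = s≤s z≤n , s≤s k≤m
flank-bounds (upper k) 1+k≤m = s≤s z≤n , m≤n⇒m≤1+n 1+k≤m

upper-below : ∀ {x} → 2 ≤ x → Σ[ F ∈ Flank (pred x) (pred x) (pred (pred x)) ] far F ≡ x
upper-below (s≤s (s≤s _)) = upper _ , refl

module Sorting (n : ℕ) where

  Unoriented : (Edge n → ℕ) → Set
  Unoriented f = ∀ e → f (swap e) ≡ f e

  norm-cases : ∀ (e : Edge n) → norm e ≡ e ⊎ norm e ≡ swap e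
  norm-cases (u , v) with toℕ u ≤ᵇ toℕ v
  ... | true  = inj₁ refl
  ... | false = inj₂ refl

  norm-swap : ∀ (e : Edge n) → norm (swap e) ≡ norm e
  norm-swap (u , v) with toℕ v ≤ᵇ toℕ u in v≤u | toℕ u ≤ᵇ toℕ v in u≤v
  ... | true  | true  = cong₂ _,_ v≡u (sym v≡u)
    where
    v≡u : v ≡ u
    v≡u = Fin.toℕ-injective (≤-antisym (≤ᵇ⇒≤ _ _ (subst T (sym v≤u) _)) (≤ᵇ⇒≤ _ _ (subst T (sym u≤v) _)))
  ... | true  | false = refl
  ... | false | true  = refl
  ... | false | false with ≤-total (toℕ u) (toℕ v)
  ...   | inj₁ u≤v′ = contradiction (subst T u≤v (≤⇒≤ᵇ u≤v′)) λ ()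
  ...   | inj₂ v≤u′ = contradiction (subst T v≤u (≤⇒≤ᵇ v≤u′)) λ ()

  norm-≡ : ∀ {e f : Edge n} → norm e ≡ norm f → e ≡ f ⊎ e ≡ swap f
  norm-≡ {e} {f} eq with norm-cases e | norm-cases f
  ... | inj₁ e≡ | inj₁ f≡ = inj₁ (trans (sym e≡) (trans eq f≡))
  ... | inj₁ e≡ | inj₂ f≡ = inj₂ (trans (sym e≡) (trans eq f≡))
  ... | inj₂ e≡ | inj₁ f≡ = inj₂ (cong swap (trans (sym e≡) (trans eq f≡)))
  ... | inj₂ e≡ | inj₂ f≡ = inj₁ (cong swap (trans (sym e≡) (trans eq f≡)))

  unoriented-norm : ∀ {f} → Unoriented f → ∀ e → f (norm e) ≡ f e
  unoriented-norm {f} f-unor e with norm-cases e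
  ... | inj₁ e≡ = cong f e≡
  ... | inj₂ e≡ = trans (cong f e≡) (f-unor e)

  unoriented-≡ : ∀ {f} → Unoriented f → ∀ {e e′} → norm e ≡ norm e′ → f e ≡ f e′
  unoriented-≡ {f} f-unor {e} {e′} eq =
    trans (sym (unoriented-norm f-unor e)) (trans (cong f eq) (unoriented-norm f-unor e′))

  ∑-≅ : ∀ {f} → Unoriented f → ∀ {G H} → G ≅ H → ∑ f G ≡ ∑ f H
  ∑-≅ {f} f-unor {G} {H} G≅H = begin
    ∑ f G            ≡⟨ ∑-cong (sym ∘ unoriented-norm f-unor) G ⟩
    ∑ (f ∘ norm) G   ≡⟨ sym (∑-map f norm G) ⟩
    ∑ f (map norm G) ≡⟨ ∑-↭ f G≅H ⟩
    ∑ f (map norm H) ≡⟨ ∑-map f norm H ⟩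
    ∑ (f ∘ norm) H   ≡⟨ ∑-cong (unoriented-norm f-unor) H ⟩
    ∑ f H            ∎
    where open ≡-Reasoning

  ≅-trans : ∀ {G H K : Genome n} → G ≅ H → H ≅ K → G ≅ K
  ≅-trans = ↭-trans

  ↭⇒≅ : ∀ {G H : Genome n} → G ↭ H → G ≅ H
  ↭⇒≅ = map⁺ norm

  ≅-∷ : ∀ {e e′} {G H : Genome n} → norm e ≡ norm e′ → G ≅ H → (e ∷ G) ≅ (e′ ∷ H)
  ≅-∷ {e′ = e′} eq G≅H rewrite eq = ↭-prep (norm e′) G≅H

  ≅-swap : ∀ e f (G : Genome n) → (e ∷ f ∷ G) ≅ (f ∷ e ∷ G)
  ≅-swap e f G = ↭-swap (norm e) (norm f) ↭-refl

  pair-≡ : ∀ {x y x′ y′ : Vertex n} → toℕ x ≡ toℕ x′ → toℕ y ≡ toℕ y′ → (x , y) ≡ (x′ , y′)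
  pair-≡ x≡ y≡ = cong₂ _,_ (Fin.toℕ-injective x≡) (Fin.toℕ-injective y≡)

  AtZero : (u v w x : Vertex n) → Set
  AtZero u v w x = u ≡ v0 ⊎ v ≡ v0 ⊎ w ≡ v0 ⊎ x ≡ v0

  Outcome : (u v w x : Vertex n) → Genome n → Genome n → Set
  Outcome u v w x R H = H ≡ (u , w) ∷ (v , x) ∷ R ⊎ H ≡ (u , x) ∷ (v , w) ∷ R

  atZero-swap₁ : ∀ {u v w x} → AtZero u v w x → AtZero v u w x
  atZero-swap₁ (inj₁ u0)        = inj₂ (inj₁ u0)
  atZero-swap₁ (inj₂ (inj₁ v0)) = inj₁ v0
  atZero-swap₁ (inj₂ (inj₂ wx)) = inj₂ (inj₂ wx)

  atZero-swap₂ : ∀ {u v w x} → AtZero u v w x → AtZero u v x w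
  atZero-swap₂ (inj₁ u0)                 = inj₁ u0
  atZero-swap₂ (inj₂ (inj₁ v0))          = inj₂ (inj₁ v0)
  atZero-swap₂ (inj₂ (inj₂ (inj₁ w0)))   = inj₂ (inj₂ (inj₂ w0))
  atZero-swap₂ (inj₂ (inj₂ (inj₂ x0)))   = inj₂ (inj₂ (inj₁ x0))

  -- Reorienting either cut edge only exchanges the two possible outcomes.
  reorient : ∀ {u v w x u′ v′ w′ x′ R R′ H} →
             (u′ , v′) ≡ (u , v) ⊎ (u′ , v′) ≡ (v , u) → (w′ , x′) ≡ (w , x) ⊎ (w′ , x′) ≡ (x , w) → R′ ≅ R →
             AtZero u v w x → Outcome u v w x R H →
             AtZero u′ v′ w′ x′ × ∃[ H′ ] (Outcome u′ v′ w′ x′ R′ H′ × H′ ≅ H)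
  reorient (inj₁ refl) (inj₁ refl) R′≅R z (inj₁ refl) =
    z , _ , inj₁ refl , ≅-∷ refl (≅-∷ refl R′≅R)
  reorient (inj₁ refl) (inj₁ refl) R′≅R z (inj₂ refl) =
    z , _ , inj₂ refl , ≅-∷ refl (≅-∷ refl R′≅R)
  reorient (inj₂ refl) (inj₁ refl) R′≅R z (inj₁ refl) =
    atZero-swap₁ z , _ , inj₂ refl , ≅-trans (≅-swap _ _ _) (≅-∷ refl (≅-∷ refl R′≅R))
  reorient (inj₂ refl) (inj₁ refl) R′≅R z (inj₂ refl) =
    atZero-swap₁ z , _ , inj₁ refl , ≅-trans (≅-swap _ _ _) (≅-∷ refl (≅-∷ refl R′≅R))
  reorient (inj₁ refl) (inj₂ refl) R′≅R z (inj₁ refl) =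
    atZero-swap₂ z , _ , inj₂ refl , ≅-∷ refl (≅-∷ refl R′≅R)
  reorient (inj₁ refl) (inj₂ refl) R′≅R z (inj₂ refl) =
    atZero-swap₂ z , _ , inj₁ refl , ≅-∷ refl (≅-∷ refl R′≅R)
  reorient (inj₂ refl) (inj₂ refl) R′≅R z (inj₁ refl) =
    atZero-swap₂ (atZero-swap₁ z) , _ , inj₁ refl , ≅-trans (≅-swap _ _ _) (≅-∷ refl (≅-∷ refl R′≅R))
  reorient (inj₂ refl) (inj₂ refl) R′≅R z (inj₂ refl) =
    atZero-swap₂ (atZero-swap₁ z) , _ , inj₂ refl , ≅-trans (≅-swap _ _ _) (≅-∷ refl (≅-∷ refl R′≅R))

  prefixDCJ-resp-≅ : ∀ {G′ G H : Genome n} → G′ ≅ G → PrefixDCJ G H → ∃[ H′ ] (PrefixDCJ G′ H′ × H′ ≅ H)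
  prefixDCJ-resp-≅ G′≅G (u , v , w , x , R , G↭ , z , out)
    with ↭-map-inv norm (↭-trans G′≅G (map⁺ norm G↭))
  ... | [] , () , _
  ... | _ ∷ [] , () , _
  ... | (u′ , v′) ∷ (w′ , x′) ∷ R′ , eqs , G′↭
    with ∷-injective eqs
  ... | e₁ , eqs′ with ∷-injective eqs′
  ... | e₂ , e₃ with reorient (norm-≡ (sym e₁)) (norm-≡ (sym e₂)) (↭-reflexive (sym e₃)) z out
  ... | z′ , H′ , out′ , H′≅H = H′ , (u′ , v′ , w′ , x′ , R′ , G′↭ , z′ , out′) , H′≅H

  reaches-resp-≅ : ∀ {k} {G′ G : Genome n} → G′ ≅ G → ReachesIdentity k G → ReachesIdentity k G′
  reaches-resp-≅ {G = G} G′≅G (done G≅id) = done (≅-trans {H = G} {K = identity n} G′≅G G≅id)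
  reaches-resp-≅ G′≅G (step dcj r) with prefixDCJ-resp-≅ G′≅G dcj
  ... | H′ , dcj′ , H′≅H = step dcj′ (reaches-resp-≅ H′≅H r)

  _⟶_ : Genome n → Genome n → Set
  G ⟶ H = ∃[ G′ ] (G ≅ G′ × PrefixDCJ G′ H)

  ⟶-reaches : ∀ {k} {G H : Genome n} → G ⟶ H → ReachesIdentity k H → ReachesIdentity (suc k) G
  ⟶-reaches (_ , G≅G′ , dcj) r = reaches-resp-≅ G≅G′ (step dcj r)

  exchange : ∀ {G R : Genome n} {p a x y} → toℕ p ≡ 0 → G ≅ ((p , a) ∷ (x , y) ∷ R) →
             G ⟶ ((p , y) ∷ (a , x) ∷ R)
  exchange p0 split = _ , split , (_ , _ , _ , _ , _ , ↭-refl , inj₁ (Fin.toℕ-injective p0) , inj₂ refl)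

  ends : ℕ → Edge n → ℕ
  ends v (p , q) = δ v (toℕ p) + δ v (toℕ q)

  joins : ℕ → ℕ → Edge n → ℕ
  joins c d (p , q) = δ c (toℕ p) * δ d (toℕ q) + δ d (toℕ p) * δ c (toℕ q)

  isAdj : ℕ → Edge n → ℕ
  isAdj i = joins i (suc i)

  deg : ℕ → Genome n → ℕ
  deg v = ∑ (ends v)

  adj : ℕ → Genome n → ℕ
  adj i = ∑ (isAdj i)

  ends-unoriented : ∀ v → Unoriented (ends v)
  ends-unoriented v (p , q) = +-comm (δ v (toℕ q)) (δ v (toℕ p))

  joins-sym : ∀ c d e → joins c d e ≡ joins d c e
  joins-sym c d (p , q) = +-comm (δ c (toℕ p) * δ d (toℕ q)) (δ d (toℕ p) * δ c (toℕ q))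

  joins-unoriented : ∀ c d → Unoriented (joins c d)
  joins-unoriented c d (p , q) =
    trans (cong₂ _+_ (*-comm (δ c (toℕ q)) (δ d (toℕ p))) (*-comm (δ d (toℕ q)) (δ c (toℕ p))))
          (joins-sym d c (p , q))

  deg-≅ : ∀ v (G H : Genome n) → G ≅ H → deg v G ≡ deg v H
  deg-≅ v G H = ∑-≅ (ends-unoriented v) {G} {H}

  adj-≅ : ∀ i (G H : Genome n) → G ≅ H → adj i G ≡ adj i H
  adj-≅ i G H = ∑-≅ (joins-unoriented i (suc i)) {G} {H}

  length-≅ : ∀ (G H : Genome n) → G ≅ H → length G ≡ length H
  length-≅ G H G≅H = trans (sym (length-map norm G)) (trans (↭-length G≅H) (length-map norm H))

  ends-at : ∀ {v} (p q : Vertex n) → toℕ p ≡ v → ends v (p , q) ≡ suc (δ v (toℕ q))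
  ends-at {v} p q refl = cong (_+ δ v (toℕ q)) (δ-refl v)

  ends-avoid : ∀ {v} (p q : Vertex n) → toℕ p ≢ v → toℕ q ≢ v → ends v (p , q) ≡ 0
  ends-avoid p q p≢v q≢v = cong₂ _+_ (δ-≢ (p≢v ∘ sym)) (δ-≢ (q≢v ∘ sym))

  private
    *δ≤ : ∀ m d x → m * δ d x ≤ m
    *δ≤ m d x = ≤-trans (*-monoʳ-≤ m (δ≤1 d x)) (≤-reflexive (*-identityʳ m))

    δ*≤ : ∀ d x m → δ d x * m ≤ m
    δ*≤ d x m = subst (_≤ m) (*-comm m (δ d x)) (*δ≤ m d x)

    1≤+ : ∀ {m k} → 1 ≤ m + k → 1 ≤ m ⊎ 1 ≤ k
    1≤+ {zero}  pos = inj₂ pos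
    1≤+ {suc m} _   = inj₁ (s≤s z≤n)

    1≤* : ∀ {m k} → 1 ≤ m * k → 1 ≤ m × 1 ≤ k
    1≤* {zero}          ()
    1≤* {suc m} {zero}  pos rewrite *-zeroʳ m = contradiction pos λ ()
    1≤* {suc m} {suc k} _   = s≤s z≤n , s≤s z≤n

  joins≤ends : ∀ c d e → joins c d e ≤ ends c e
  joins≤ends c d (p , q) = +-mono-≤ (*δ≤ _ d (toℕ q)) (δ*≤ d (toℕ p) _)

  joins≤ends′ : ∀ c d e → joins c d e ≤ ends d e
  joins≤ends′ c d e = subst (_≤ ends d e) (joins-sym d c e) (joins≤ends d c e)

  joins≤1 : ∀ {c d} e → c ≢ d → joins c d e ≤ 1
  joins≤1 {c} {d} (p , q) c≢d =
    ≤-trans (+-mono-≤ (*δ≤ (δ c (toℕ p)) d (toℕ q)) (*δ≤ (δ d (toℕ p)) c (toℕ q))) (δ+δ≤1 (toℕ p) c≢d)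

  joins+joins≤ends : ∀ {c d d′} e → d ≢ d′ → joins c d e + joins c d′ e ≤ ends c e
  joins+joins≤ends {c} {d} {d′} (p , q) d≢d′ = begin
    joins c d (p , q) + joins c d′ (p , q)     ≡⟨ regroup (δ c (toℕ p)) (δ d (toℕ q)) (δ d (toℕ p)) (δ c (toℕ q))
                                                          (δ d′ (toℕ q)) (δ d′ (toℕ p)) ⟩
    δ c (toℕ p) * (δ d (toℕ q) + δ d′ (toℕ q)) + δ c (toℕ q) * (δ d (toℕ p) + δ d′ (toℕ p))
                                                ≤⟨ +-mono-≤ (*-monoʳ-≤ (δ c (toℕ p)) (δ+δ≤1 (toℕ q) d≢d′))
                                                            (*-monoʳ-≤ (δ c (toℕ q)) (δ+δ≤1 (toℕ p) d≢d′)) ⟩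
    δ c (toℕ p) * 1 + δ c (toℕ q) * 1          ≡⟨ cong₂ _+_ (*-identityʳ (δ c (toℕ p))) (*-identityʳ (δ c (toℕ q))) ⟩
    ends c (p , q)                              ∎
    where
    open ≤-Reasoning
    regroup : ∀ a b c d e f → a * b + c * d + (a * e + f * d) ≡ a * (b + e) + d * (c + f)
    regroup = solve-∀

  joins-inv : ∀ {c d} (p q : Vertex n) → 1 ≤ joins c d (p , q) →
              (toℕ p ≡ c × toℕ q ≡ d) ⊎ (toℕ p ≡ d × toℕ q ≡ c)
  joins-inv {c} {d} p q pos with 1≤+ {δ c (toℕ p) * δ d (toℕ q)} pos
  ... | inj₁ pos₁ with 1≤* {δ c (toℕ p)} pos₁
  ...   | cp , dq = inj₁ (sym (δ-≡ cp) , sym (δ-≡ dq))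
  joins-inv {c} {d} p q pos | inj₂ pos₂ with 1≤* {δ d (toℕ p)} pos₂
  ...   | dp , cq = inj₂ (sym (δ-≡ dp) , sym (δ-≡ cq))

  joins-≡1 : ∀ {c d} (p q : Vertex n) → c ≢ d →
             (toℕ p ≡ c × toℕ q ≡ d) ⊎ (toℕ p ≡ d × toℕ q ≡ c) → joins c d (p , q) ≡ 1
  joins-≡1 {c} {d} p q c≢d (inj₁ (refl , refl)) rewrite δ-refl c | δ-refl d | δ-≢ (c≢d ∘ sym) = refl
  joins-≡1 {c} {d} p q c≢d (inj₂ (refl , refl)) rewrite δ-refl c | δ-refl d | δ-≢ c≢d = refl

  joins-≡0 : ∀ {c d} (p q : Vertex n) → toℕ p ≢ c → toℕ p ≢ d → joins c d (p , q) ≡ 0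
  joins-≡0 {c} {d} p q p≢c p≢d rewrite δ-≢ (p≢c ∘ sym) | δ-≢ (p≢d ∘ sym) = refl

  isAdj≤1 : ∀ i e → isAdj i e ≤ 1
  isAdj≤1 i e = joins≤1 e (1+n≢n ∘ sym)

  isAdj-≡1 : ∀ {i} e → 1 ≤ isAdj i e → isAdj i e ≡ 1
  isAdj-≡1 {i} e pos = ≤-antisym (isAdj≤1 i e) pos

  isAdj-from0 : ∀ {i} (p q : Vertex n) → toℕ p ≡ 0 → 1 ≤ i → isAdj i (p , q) ≡ 0
  isAdj-from0 p q p0 1≤i = joins-≡0 p q (λ p≡i → contradiction (subst (1 ≤_) (trans (sym p≡i) p0) 1≤i) λ ())
                                         (λ p≡1+i → 1+n≢0 (trans (sym p≡1+i) p0))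

  isAdj-at : ∀ {t i} (p q : Vertex n) → toℕ p ≡ t → 1 ≤ isAdj i (p , q) →
             (i ≡ t × toℕ q ≡ suc t) ⊎ (suc i ≡ t × toℕ q ≡ i)
  isAdj-at {i = i} p q refl pos with joins-inv {i} {suc i} p q pos
  ... | inj₁ (p≡ , q≡) = inj₁ (sym p≡ , trans q≡ (cong suc (sym p≡)))
  ... | inj₂ (p≡ , q≡) = inj₂ (sym p≡ , q≡)

  isAdj-index-unique : ∀ {i j} e → 1 ≤ isAdj i e → 1 ≤ isAdj j e → i ≡ j
  isAdj-index-unique {i} {j} (p , q) posᵢ posⱼ with joins-inv {i} {suc i} p q posᵢ | joins-inv {j} {suc j} p q posⱼ
  ... | inj₁ (pᵢ , _)  | inj₁ (pⱼ , _)  = trans (sym pᵢ) pⱼ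
  ... | inj₁ (pᵢ , qᵢ) | inj₂ (pⱼ , qⱼ) = contradiction (trans (cong suc (trans (sym pⱼ) pᵢ)) (trans (sym qᵢ) qⱼ)) (2+m≢m j)
  ... | inj₂ (pᵢ , qᵢ) | inj₁ (pⱼ , qⱼ) = contradiction (trans (cong suc (trans (sym pᵢ) pⱼ)) (trans (sym qⱼ) qᵢ)) (2+m≢m i)
  ... | inj₂ (pᵢ , _)  | inj₂ (pⱼ , _)  = suc-injective (trans (sym pᵢ) pⱼ)

  isAdj-norm : ∀ {i} e f → 1 ≤ isAdj i e → 1 ≤ isAdj i f → norm e ≡ norm f
  isAdj-norm {i} (x , y) (x′ , y′) pos pos′ with joins-inv {i} {suc i} x y pos | joins-inv {i} {suc i} x′ y′ pos′
  ... | inj₁ (x≡ , y≡) | inj₁ (x′≡ , y′≡) = cong norm (pair-≡ (trans x≡ (sym x′≡)) (trans y≡ (sym y′≡)))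
  ... | inj₁ (x≡ , y≡) | inj₂ (x′≡ , y′≡) =
    trans (cong norm (pair-≡ (trans x≡ (sym y′≡)) (trans y≡ (sym x′≡)))) (norm-swap (x′ , y′))
  ... | inj₂ (x≡ , y≡) | inj₁ (x′≡ , y′≡) =
    trans (cong norm (pair-≡ (trans x≡ (sym y′≡)) (trans y≡ (sym x′≡)))) (norm-swap (x′ , y′))
  ... | inj₂ (x≡ , y≡) | inj₂ (x′≡ , y′≡) = cong norm (pair-≡ (trans x≡ (sym x′≡)) (trans y≡ (sym y′≡)))

  isAdj-not-loop : ∀ {i} (p q : Vertex n) → 1 ≤ isAdj i (p , q) → toℕ q ≢ toℕ p
  isAdj-not-loop {i} p q isAdjᵢ with joins-inv {i} {suc i} p q isAdjᵢ
  ... | inj₁ (p≡ , q≡) = λ q≡p → 1+n≢n (trans (sym q≡) (trans q≡p p≡))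
  ... | inj₂ (p≡ , q≡) = λ q≡p → 1+n≢n (trans (sym p≡) (trans (sym q≡p) q≡))

  vertex≤ : ∀ (p : Vertex n) → toℕ p ≤ suc n
  vertex≤ = Fin.toℕ≤pred[n]

  orient : ∀ v (e : Edge n) → 1 ≤ ends v e → ∃[ p ] ∃[ q ] (toℕ p ≡ v × norm e ≡ norm (p , q))
  orient v (p , q) pos with v ≟ toℕ p
  ... | yes v≡p = p , q , sym v≡p , refl
  ... | no  v≢p rewrite δ-≢ v≢p = q , p , sym (δ-≡ pos) , norm-swap (q , p)

  EdgeAt : (Edge n → ℕ) → ℕ → Genome n → Set
  EdgeAt f v G = ∃[ p ] ∃[ q ] ∃[ R ] (toℕ p ≡ v × G ≅ ((p , q) ∷ R) × 1 ≤ f (p , q))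

  edge-at : ∀ v {f} (G : Genome n) → Unoriented f → (∀ e → f e ≤ ends v e) → 1 ≤ ∑ f G → EdgeAt f v G
  edge-at v {f} G f-unor f≤ends pos with ∑-positive f G pos
  ... | e , R , G↭ , fe with orient v e (≤-trans fe (f≤ends e))
  ...   | p , q , p≡v , e≅ =
    p , q , R , p≡v , ≅-trans {H = e ∷ R} (↭⇒≅ G↭) (≅-∷ e≅ ↭-refl) , subst (1 ≤_) (unoriented-≡ f-unor e≅) fe

  deg-rest : ∀ {v} (G R : Genome n) (p a : Vertex n) → G ≅ ((p , a) ∷ R) → toℕ a ≡ v → toℕ p ≢ v → deg v G ≡ suc (deg v R)
  deg-rest {v} G R p a split a≡v p≢v =
    trans (deg-≅ v G _ split)
          (cong (_+ deg v R) (trans (ends-unoriented v (a , p)) (trans (ends-at a p a≡v) (cong suc (δ-≢ (p≢v ∘ sym))))))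

  ends-adjacency : ∀ {t i} (p q : Vertex n) → toℕ p ≡ t → 1 ≤ isAdj i (p , q) → ends t (p , q) ≡ 1
  ends-adjacency p q refl isAdjᵢ = trans (ends-at p q refl) (cong suc (δ-≢ (isAdj-not-loop p q isAdjᵢ ∘ sym)))

  adj-tail : ∀ {j} (R R′ : Genome n) e → R ≅ (e ∷ R′) → adj j R ≡ 0 → isAdj j e ≡ 0 × adj j R′ ≡ 0
  adj-tail {j} R R′ e split none = m+n≡0⇒m≡0 (isAdj j e) total , m+n≡0⇒n≡0 (isAdj j e) total
    where
    total : isAdj j e + adj j R′ ≡ 0
    total = trans (sym (adj-≅ j R (e ∷ R′) split)) none

  adj-drop0 : ∀ {j} (G R : Genome n) (p a : Vertex n) → G ≅ ((p , a) ∷ R) → toℕ p ≡ 0 → 1 ≤ j → adj j G ≡ adj j R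
  adj-drop0 {j} G R p a split p0 1≤j = trans (adj-≅ j G _ split) (cong (_+ adj j R) (isAdj-from0 p a p0 1≤j))

  isAdj≤adj : ∀ {j} (R R′ : Genome n) e → R ≅ (e ∷ R′) → isAdj j e ≤ adj j R
  isAdj≤adj {j} R R′ e split = subst (isAdj j e ≤_) (sym (adj-≅ j R (e ∷ R′) split)) (m≤m+n _ _)

  adj-∷∷ : ∀ {s} e f (R : Genome n) → isAdj s f ≤ adj s (e ∷ f ∷ R)
  adj-∷∷ {s} e f R = ≤-trans (m≤m+n (isAdj s f) (adj s R)) (m≤n+m (isAdj s f + adj s R) (isAdj s e))

  adj-absent : ∀ {s v} (R : Genome n) → v ≡ s ⊎ v ≡ suc s → deg v R ≡ 0 → adj s R ≡ 0
  adj-absent {s} R v≡ noEdge = n≤0⇒n≡0 (≤-trans (∑-mono R λ e _ → bound v≡ e) (≤-reflexive noEdge))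
    where
    bound : ∀ {v} → v ≡ s ⊎ v ≡ suc s → ∀ e → isAdj s e ≤ ends v e
    bound (inj₁ refl) e = joins≤ends s (suc s) e
    bound (inj₂ refl) e = joins≤ends′ s (suc s) e

  -- Well-formed genomes

  record WellFormed (G : Genome n) : Set where
    field
      size      : length G ≡ suc n
      deg-first : deg 0 G ≡ 1
      deg-last  : deg (suc n) G ≡ 1
      deg-inner : ∀ v → 1 ≤ v → v ≤ n → deg v G ≡ 2

  wellFormed-transport : ∀ {G H} → length H ≡ length G → (∀ v → deg v H ≡ deg v G) → WellFormed G → WellFormed H
  wellFormed-transport size≡ deg≡ wf = record
    { size      = trans size≡ size
    ; deg-first = trans (deg≡ 0) deg-first
    ; deg-last  = trans (deg≡ (suc n)) deg-last
    ; deg-inner = λ v 1≤v v≤n → trans (deg≡ v) (deg-inner v 1≤v v≤n)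
    }
    where open WellFormed wf

  wellFormed-exchange : ∀ {G R : Genome n} {p a x y} → G ≅ ((p , a) ∷ (x , y) ∷ R) → WellFormed G →
                        WellFormed ((p , y) ∷ (a , x) ∷ R)
  wellFormed-exchange {G} {R} {p} {a} {x} {y} split =
    wellFormed-transport (sym (length-≅ G _ split)) λ v →
      trans (regroup (δ v (toℕ p)) (δ v (toℕ a)) (δ v (toℕ x)) (δ v (toℕ y)) (deg v R))
            (sym (deg-≅ v G _ split))
    where
    regroup : ∀ a b c d r → a + d + (b + c + r) ≡ a + b + (c + d + r)
    regroup = solve-∀

  deg≥1 : ∀ {G} → WellFormed G → ∀ {v} → 1 ≤ v → v ≤ suc n → 1 ≤ deg v G
  deg≥1 wf {v} 1≤v v≤1+n with v ≤? n
  ... | yes v≤n = subst (1 ≤_) (sym (WellFormed.deg-inner wf v 1≤v v≤n)) (s≤s z≤n)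
  ... | no  v≰n rewrite ≤-antisym v≤1+n (≰⇒> v≰n) = ≤-reflexive (sym (WellFormed.deg-last wf))

  deg≤2 : ∀ {G} → WellFormed G → ∀ {v} → 1 ≤ v → v ≤ suc n → deg v G ≤ 2
  deg≤2 wf {v} 1≤v v≤1+n with v ≤? n
  ... | yes v≤n = ≤-reflexive (WellFormed.deg-inner wf v 1≤v v≤n)
  ... | no  v≰n rewrite ≤-antisym v≤1+n (≰⇒> v≰n) = ≤-trans (≤-reflexive (WellFormed.deg-last wf)) (s≤s z≤n)

  no-zero-adjacency : ∀ {H K : Genome n} {p y} → WellFormed H → H ≅ ((p , y) ∷ K) → toℕ p ≡ 0 → toℕ y ≢ 1 → adj 0 H ≡ 0
  no-zero-adjacency {H} {K} {p} {y} wf split p0 y≢1 =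
    trans (adj-≅ 0 H _ split) (cong₂ _+_ isAdj-py (adj-absent K (inj₁ refl) deg0K))
    where
    deg0K : deg 0 K ≡ 0
    deg0K = m+n≡0⇒n≡0 (δ 0 (toℕ y)) (suc-injective (begin
      suc (δ 0 (toℕ y) + deg 0 K) ≡⟨ cong (_+ deg 0 K) (sym (ends-at p y p0)) ⟩
      ends 0 (p , y) + deg 0 K    ≡⟨ sym (deg-≅ 0 H _ split) ⟩
      deg 0 H                     ≡⟨ WellFormed.deg-first wf ⟩
      1                           ∎))
      where open ≡-Reasoning
    isAdj-py : isAdj 0 (p , y) ≡ 0
    isAdj-py = ¬1≤⇒≡0 λ pos → case (joins-inv {0} {1} p y pos)
      where
      case : (toℕ p ≡ 0 × toℕ y ≡ 1) ⊎ (toℕ p ≡ 1 × toℕ y ≡ 0) → ⊥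
      case (inj₁ (_ , y1))  = y≢1 y1
      case (inj₂ (p1 , _)) = 1+n≢0 (trans (sym p1) p0)

  absent-adjacent : ∀ {G R : Genome n} {p a} → G ≅ ((p , a) ∷ R) → toℕ p ≡ 0 → toℕ a ≡ 1 → absent (adj 0 G) ≡ 0
  absent-adjacent {G} {R} {p} {a} split p0 a1 =
    absent-positive (subst (1 ≤_) (sym (adj-≅ 0 G ((p , a) ∷ R) split))
                     (≤-trans (≤-reflexive (sym (joins-≡1 {0} {1} p a (λ ()) (inj₁ (p0 , a1)))))
                              (m≤m+n (isAdj 0 (p , a)) (adj 0 R))))

  -- Missing adjacencies

  inner : List ℕ
  inner = applyUpTo suc n

  ∈-inner⁻ : ∀ {i} → i ∈ inner → 1 ≤ i × i ≤ n
  ∈-inner⁻ i∈ with ∈-applyUpTo⁻ suc i∈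
  ... | j , j<n , refl = s≤s z≤n , j<n

  ∈-inner⁺ : ∀ {i} → 1 ≤ i → i ≤ n → i ∈ inner
  ∈-inner⁺ {suc j} _ 1+j≤n = ∈-applyUpTo⁺ suc 1+j≤n

  missing : Genome n → ℕ
  missing G = ∑ (λ i → absent (adj i G)) inner

  record Keeps (G H : Genome n) : Set where
    constructor keeping
    field kept : ∀ i → 1 ≤ i → 1 ≤ adj i G → 1 ≤ adj i H

  missing-mono : ∀ {G H} → Keeps G H → missing H ≤ missing G
  missing-mono (keeping keeps) = ∑-mono inner λ i i∈ → absent-anti (keeps i (proj₁ (∈-inner⁻ i∈)))

  missing-< : ∀ {G H} → Keeps G H → ∀ {s} → 1 ≤ s → s ≤ n → adj s G ≡ 0 → 1 ≤ adj s H → missing H < missing G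
  missing-< (keeping keeps) 1≤s s≤n absentG presentH =
    ∑-mono-< inner (λ i i∈ → absent-anti (keeps i (proj₁ (∈-inner⁻ i∈)))) (∈-inner⁺ 1≤s s≤n) (absent-drop absentG presentH)

  keeps-∷ : ∀ {G R} e → Keeps G R → Keeps G (e ∷ R)
  keeps-∷ e (keeping keeps) = keeping λ j 1≤j present → ≤-trans (keeps j 1≤j present) (m≤n+m _ (isAdj j e))

  Complete : Genome n → Set
  Complete G = ∀ i → 1 ≤ i → i ≤ n → 1 ≤ adj i G

  FirstMissing : Genome n → ℕ → Set
  FirstMissing G m = 1 ≤ m × m ≤ n × adj m G ≡ 0 × (∀ i → 1 ≤ i → i < m → 1 ≤ adj i G)

  complete-or-firstMissing : ∀ G → Complete G ⊎ ∃[ m ] FirstMissing G m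
  complete-or-firstMissing G with first-failure (λ i → 1 ≤ adj i G) (λ i → 1 ≤? adj i G) n
  ... | inj₁ complete = inj₁ complete
  ... | inj₂ (m , 1≤m , m≤n , ¬present , below) = inj₂ (m , 1≤m , m≤n , ¬1≤⇒≡0 ¬present , below)

  adjEdge : Fin (suc n) → Edge n
  adjEdge i = (inject₁ i , fsuc i)

  isAdj-adjEdge : ∀ i → isAdj (toℕ i) (adjEdge i) ≡ 1
  isAdj-adjEdge i = joins-≡1 (inject₁ i) (fsuc i) (1+n≢n ∘ sym) (inj₁ (Fin.toℕ-inject₁ i , refl))

  contains-adjacencies : ∀ {m} (h : Fin m → Fin (suc n)) → (∀ {l l′} → h l ≡ h l′ → l ≡ l′) → ∀ (G : Genome n) →
                         (∀ l → 1 ≤ adj (toℕ (h l)) G) → ∃[ rest ] G ≅ (tabulate (adjEdge ∘ h) ++ rest)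
  contains-adjacencies {zero}  h _     G _       = G , ↭-refl
  contains-adjacencies {suc m} h h-inj G present
    with ∑-positive (isAdj (toℕ (h fzero))) G (present fzero)
  ... | e , G′ , G↭ , isAdj-e with contains-adjacencies (h ∘ fsuc) (Fin.suc-injective ∘ h-inj) G′ present′
    where
    present′ : ∀ l → 1 ≤ adj (toℕ (h (fsuc l))) G′
    present′ l = subst (1 ≤_) (trans (∑-↭ (isAdj (toℕ (h (fsuc l)))) G↭) (cong (_+ adj (toℕ (h (fsuc l))) G′) (¬1≤⇒≡0 other)))
                          (present (fsuc l))
      where
      other : ¬ 1 ≤ isAdj (toℕ (h (fsuc l))) e
      other isAdj-e′ = contradiction (h-inj (Fin.toℕ-injective (isAdj-index-unique e isAdj-e isAdj-e′))) λ ()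
  ... | rest , G′≅ =
    rest , ≅-trans {H = e ∷ G′} (↭⇒≅ G↭)
                   (≅-∷ (isAdj-norm e (adjEdge (h fzero)) isAdj-e (≤-reflexive (sym (isAdj-adjEdge (h fzero))))) G′≅)

  identity-of-complete : ∀ {G R : Genome n} {p a} → WellFormed G → G ≅ ((p , a) ∷ R) → toℕ p ≡ 0 → toℕ a ≡ 1 →
                         Complete G → G ≅ identity n
  identity-of-complete {G} {R} {p} {a} wf split p0 a1 complete
    with contains-adjacencies fsuc Fin.suc-injective R present
    where
    present : ∀ l → 1 ≤ adj (suc (toℕ l)) R
    present l = subst (1 ≤_) (adj-drop0 G R p a split p0 (s≤s z≤n)) (complete _ (s≤s z≤n) (Fin.toℕ<n l))
  ... | rest , R≅ = ≅-trans {H = (p , a) ∷ R} {K = identity n} split (subst (((p , a) ∷ R) ≅_) (sym identity-unfold) unfolded)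
    where
    identity-unfold : identity n ≡ adjEdge fzero ∷ tabulate (adjEdge ∘ fsuc)
    identity-unfold = map-tabulate (λ i → i) adjEdge
    length-R : length R ≡ n
    length-R = suc-injective (trans (sym (length-≅ G _ split)) (WellFormed.size wf))
    no-rest : ∀ rest → R ≅ (tabulate (adjEdge ∘ fsuc) ++ rest) → R ≅ tabulate (adjEdge ∘ fsuc)
    no-rest []       R≅ = subst (R ≅_) (++-identityʳ _) R≅
    no-rest (e ∷ es) R≅ = contradiction (begin
      n + suc (length es)                                  ≡⟨ cong (_+ suc (length es)) (sym (length-tabulate (adjEdge ∘ fsuc))) ⟩
      length (tabulate (adjEdge ∘ fsuc)) + length (e ∷ es) ≡⟨ sym (length-++ (tabulate (adjEdge ∘ fsuc))) ⟩
      length (tabulate (adjEdge ∘ fsuc) ++ e ∷ es)         ≡⟨ sym (length-≅ R _ R≅) ⟩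
      length R                                             ≡⟨ length-R ⟩
      n                                                    ∎) (m+1+n≢m n)
      where open ≡-Reasoning
    unfolded : ((p , a) ∷ R) ≅ (adjEdge fzero ∷ tabulate (adjEdge ∘ fsuc))
    unfolded = ≅-∷ {e′ = adjEdge fzero} (cong norm (pair-≡ p0 a1)) (no-rest rest R≅)

  -- Safe cuts

  NonAdjacency : Edge n → Set
  NonAdjacency e = ∀ j → 1 ≤ j → isAdj j e ≡ 0

  keeps-drop-nonAdjacency : ∀ {R R′ e} → R ≅ (e ∷ R′) → NonAdjacency e → Keeps R R′
  keeps-drop-nonAdjacency {R} {R′} {e} split nonAdj = keeping λ j 1≤j present →
    subst (1 ≤_) (trans (adj-≅ j R (e ∷ R′) split) (cong (_+ adj j R′) (nonAdj j 1≤j))) present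

  keeps-drop-duplicate : ∀ {R R′ e i} → R ≅ (e ∷ R′) → 1 ≤ isAdj i e → 1 ≤ adj i R′ → Keeps R R′
  keeps-drop-duplicate {R} {R′} {e} {i} split isAdjᵢ stillᵢ = keeping kept′
    where
    kept′ : ∀ j → 1 ≤ j → 1 ≤ adj j R → 1 ≤ adj j R′
    kept′ j 1≤j present with j ≟ i
    ... | yes refl = stillᵢ
    ... | no  j≢i  = subst (1 ≤_) (trans (adj-≅ j R (e ∷ R′) split) (cong (_+ adj j R′) (¬1≤⇒≡0 other))) present
      where
      other : ¬ 1 ≤ isAdj j e
      other isAdjⱼ = j≢i (isAdj-index-unique e isAdjⱼ isAdjᵢ)

  flank-nonAdjacency : ∀ {t s i} (p q : Vertex n) → Flank t s i → toℕ p ≡ t →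
                       isAdj s (p , q) ≡ 0 → isAdj i (p , q) ≡ 0 → NonAdjacency (p , q)
  flank-nonAdjacency {s = s} {i} p q F p≡t not-s not-i j _ = ¬1≤⇒≡0 λ isAdjⱼ →
    excluded (flank-index F (Data.Sum.map proj₁ proj₁ (isAdj-at p q p≡t isAdjⱼ))) isAdjⱼ
    where
    excluded : ∀ {j} → j ≡ s ⊎ j ≡ i → ¬ 1 ≤ isAdj j (p , q)
    excluded (inj₁ refl) isAdjₛ = contradiction (subst (1 ≤_) not-s isAdjₛ) λ ()
    excluded (inj₂ refl) isAdjᵢ = contradiction (subst (1 ≤_) not-i isAdjᵢ) λ ()

  flank-target≤n : ∀ {t s i} (p q : Vertex n) → Flank t s i → s ≤ n → toℕ p ≡ t → 1 ≤ isAdj i (p , q) → t ≤ n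
  flank-target≤n p q (lower k) _ p≡t isAdjᵢ with isAdj-at p q p≡t isAdjᵢ
  ... | inj₁ (_ , q≡) = ≤-pred (subst (_≤ suc n) q≡ (vertex≤ q))
  ... | inj₂ (eq , _) = contradiction eq 1+n≢n
  flank-target≤n p q (upper k) s≤n _ _ = s≤n

  record SafeEdge (R : Genome n) (t : ℕ) : Set where
    constructor safe-edge
    field
      tp y  : Vertex n
      rest  : Genome n
      tp≡t  : toℕ tp ≡ t
      split : R ≅ ((tp , y) ∷ rest)
      keeps : Keeps R rest

  -- Since s is absent, an edge at t can only carry the adjacency i. If the first edge at t does,
  -- t is inner, and the second edge at t carries no adjacency or is a second copy of i.
  safe-edge-at : ∀ {t s i} (R : Genome n) → Flank t s i → s ≤ n → adj s R ≡ 0 →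
                 1 ≤ deg t R → (t ≤ n → deg t R ≡ 2) → SafeEdge R t
  safe-edge-at {t} {s} {i} R F s≤n noS deg≥1 inner⇒2 = from-first (edge-at t R (ends-unoriented t) (λ _ → ≤-refl) deg≥1)
    where
    from-first : EdgeAt (ends t) t R → SafeEdge R t
    from-first (t₁ , y₁ , R₁ , t₁≡t , split₁ , _) = choose (1 ≤? isAdj i (t₁ , y₁))
      where
      noS₁ : isAdj s (t₁ , y₁) ≡ 0 × adj s R₁ ≡ 0
      noS₁ = adj-tail R R₁ (t₁ , y₁) split₁ noS

      from-second : 1 ≤ isAdj i (t₁ , y₁) → EdgeAt (ends t) t R₁ → SafeEdge R t
      from-second is-i (t₂ , y₂ , R₂ , t₂≡t , split₂ , _) = choose₂ (1 ≤? isAdj i (t₂ , y₂))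
        where
        split : R ≅ ((t₂ , y₂) ∷ (t₁ , y₁) ∷ R₂)
        split = ≅-trans {H = (t₁ , y₁) ∷ (t₂ , y₂) ∷ R₂} (≅-trans {H = (t₁ , y₁) ∷ R₁} split₁ (≅-∷ refl split₂))
                        (≅-swap (t₁ , y₁) (t₂ , y₂) R₂)
        choose₂ : Dec (1 ≤ isAdj i (t₂ , y₂)) → SafeEdge R t
        choose₂ (yes is-i₂) =
          safe-edge t₁ y₁ R₁ t₁≡t split₁
            (keeps-drop-duplicate split₁ is-i (≤-trans is-i₂ (isAdj≤adj R₁ R₂ (t₂ , y₂) split₂)))
        choose₂ (no not-i₂) =
          safe-edge t₂ y₂ ((t₁ , y₁) ∷ R₂) t₂≡t split
            (keeps-drop-nonAdjacency split
              (flank-nonAdjacency t₂ y₂ F t₂≡t (proj₁ (adj-tail R₁ R₂ (t₂ , y₂) split₂ (proj₂ noS₁))) (¬1≤⇒≡0 not-i₂)))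

      choose : Dec (1 ≤ isAdj i (t₁ , y₁)) → SafeEdge R t
      choose (no not-i) =
        safe-edge t₁ y₁ R₁ t₁≡t split₁
          (keeps-drop-nonAdjacency split₁ (flank-nonAdjacency t₁ y₁ F t₁≡t (proj₁ noS₁) (¬1≤⇒≡0 not-i)))
      choose (yes is-i) = from-second is-i (edge-at t R₁ (ends-unoriented t) (λ _ → ≤-refl) (≤-reflexive (sym deg₁)))
        where
        open ≡-Reasoning
        deg₁ : deg t R₁ ≡ 1
        deg₁ = suc-injective (begin
          suc (deg t R₁)              ≡⟨ cong (_+ deg t R₁) (sym (ends-adjacency t₁ y₁ t₁≡t is-i)) ⟩
          ends t (t₁ , y₁) + deg t R₁ ≡⟨ sym (deg-≅ t R _ split₁) ⟩
          deg t R                     ≡⟨ inner⇒2 (flank-target≤n t₁ y₁ F s≤n t₁≡t is-i) ⟩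
          2                           ∎)

  flank-creates : ∀ {t s i} (a tp : Vertex n) (F : Flank t s i) → toℕ a ≡ far F → toℕ tp ≡ t → isAdj s (a , tp) ≡ 1
  flank-creates a tp (lower k) a≡ tp≡t = joins-≡1 a tp (1+n≢n ∘ sym) (inj₁ (a≡ , tp≡t))
  flank-creates a tp (upper k) a≡ tp≡t = joins-≡1 a tp (1+n≢n ∘ sym) (inj₂ (a≡ , tp≡t))

  record SafeCut (G : Genome n) (p a : Vertex n) (t : ℕ) : Set where
    constructor safe-cut
    field
      tp y  : Vertex n
      rest  : Genome n
      tp≡t  : toℕ tp ≡ t
      split : G ≅ ((p , a) ∷ (tp , y) ∷ rest)
      keeps : Keeps G rest

    joined : Genome n
    joined = (p , y) ∷ (a , tp) ∷ rest

  safe-cut-at : ∀ {G R : Genome n} {p a t s i} → WellFormed G → G ≅ ((p , a) ∷ R) → toℕ p ≡ 0 → toℕ a ≢ t →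
                Flank t s i → s ≤ n → adj s G ≡ 0 → SafeCut G p a t
  safe-cut-at {G} {R} {p} {a} {t} {s} wf split p0 a≢t F s≤n noS = extend (safe-edge-at R F s≤n noS-R deg-R≥1 inner⇒2)
    where
    1≤t : 1 ≤ t
    1≤t = proj₁ (flank-bounds F s≤n)
    deg≡ : deg t G ≡ deg t R
    deg≡ = trans (deg-≅ t G _ split)
                 (cong (_+ deg t R) (ends-avoid p a (λ p≡t → contradiction (subst (1 ≤_) (trans (sym p≡t) p0) 1≤t) λ ()) a≢t))
    noS-R : adj s R ≡ 0
    noS-R = proj₂ (adj-tail G R (p , a) split noS)
    deg-R≥1 : 1 ≤ deg t R
    deg-R≥1 = subst (1 ≤_) deg≡ (deg≥1 wf 1≤t (proj₂ (flank-bounds F s≤n)))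
    inner⇒2 : t ≤ n → deg t R ≡ 2
    inner⇒2 t≤n = trans (sym deg≡) (WellFormed.deg-inner wf t 1≤t t≤n)
    extend : SafeEdge R t → SafeCut G p a t
    extend (safe-edge tp y R′ tp≡t splitR (keeping keepsR)) =
      safe-cut tp y R′ tp≡t (≅-trans {H = (p , a) ∷ R} split (≅-∷ refl splitR))
        (keeping λ j 1≤j present → keepsR j 1≤j (subst (1 ≤_) (adj-drop0 G R p a split p0 1≤j) present))

  join : ∀ {G R : Genome n} {p a t s i} → WellFormed G → G ≅ ((p , a) ∷ R) → toℕ p ≡ 0 →
         (F : Flank t s i) → toℕ a ≡ far F → 1 ≤ s → s ≤ n → adj s G ≡ 0 →
         Σ[ c ∈ SafeCut G p a t ] missing (SafeCut.joined c) < missing G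
  join {G} {_} {p} {a} {t} {s} wf split p0 F a≡ 1≤s s≤n noS =
    with-gain (safe-cut-at wf split p0 (λ a≡t → far≢ F (trans (sym a≡) a≡t)) F s≤n noS)
    where
    with-gain : (c : SafeCut G p a t) → Σ[ c′ ∈ SafeCut G p a t ] missing (SafeCut.joined c′) < missing G
    with-gain c = c , missing-< {G} {joined} (keeps-∷ (p , y) (keeps-∷ (a , tp) keeps)) 1≤s s≤n noS
                        (subst (_≤ adj s joined) (flank-creates a tp F a≡ tp≡t) (adj-∷∷ (p , y) (a , tp) rest))
      where open SafeCut c

  -- Sorting

  Sortable : Genome n → Set
  Sortable G = ∃[ k ] (ReachesIdentity k G × 2 * k + absent (adj 0 G) ≤ 3 * missing G)

  sortable-after : ∀ {G H} → G ⟶ H → missing H < missing G → Sortable H → Sortable G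
  sortable-after {G} {H} G⟶H fewer (k , r , bound) = suc k , ⟶-reaches G⟶H r , (begin
    2 * suc k + absent (adj 0 G) ≤⟨ +-monoʳ-≤ (2 * suc k) (absent≤1 (adj 0 G)) ⟩
    2 * suc k + 1                ≡⟨ shift k ⟩
    2 * k + 3                    ≤⟨ +-monoˡ-≤ 3 (≤-trans (m≤m+n (2 * k) _) bound) ⟩
    3 * missing H + 3            ≡⟨ triple (missing H) ⟩
    3 * suc (missing H)          ≤⟨ *-monoʳ-≤ 3 fewer ⟩
    3 * missing G                ∎)
    where
    open ≤-Reasoning
    shift : ∀ k → 2 * suc k + 1 ≡ 2 * k + 3
    shift = solve-∀
    triple : ∀ m → 3 * m + 3 ≡ 3 * suc m
    triple = solve-∀

  sortable-after₂ : ∀ {G H₁ H₂} → G ⟶ H₁ → H₁ ⟶ H₂ → missing H₂ < missing G →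
                    absent (adj 0 G) ≡ 0 → absent (adj 0 H₂) ≡ 1 → Sortable H₂ → Sortable G
  sortable-after₂ {G} {H₁} {H₂} G⟶H₁ H₁⟶H₂ fewer has01 lost01 (k , r , bound) =
    suc (suc k) , ⟶-reaches G⟶H₁ (⟶-reaches H₁⟶H₂ r) , (begin
      2 * suc (suc k) + absent (adj 0 G) ≡⟨ cong (2 * suc (suc k) +_) has01 ⟩
      2 * suc (suc k) + 0                ≡⟨ shift k ⟩
      (2 * k + 1) + 3                    ≤⟨ +-monoˡ-≤ 3 (subst (λ x → 2 * k + x ≤ 3 * missing H₂) lost01 bound) ⟩
      3 * missing H₂ + 3                 ≡⟨ triple (missing H₂) ⟩
      3 * suc (missing H₂)               ≤⟨ *-monoʳ-≤ 3 fewer ⟩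
      3 * missing G                      ∎)
    where
    open ≤-Reasoning
    shift : ∀ k → 2 * suc (suc k) + 0 ≡ (2 * k + 1) + 3
    shift = solve-∀
    triple : ∀ m → 3 * m + 3 ≡ 3 * suc m
    triple = solve-∀

  SortableBelow : Genome n → Set
  SortableBelow G = ∀ {H} → missing H < missing G → WellFormed H → Sortable H

  sortable-by-join : ∀ {G : Genome n} {p a t} → WellFormed G → toℕ p ≡ 0 → SortableBelow G →
                     Σ[ c ∈ SafeCut G p a t ] missing (SafeCut.joined c) < missing G → Sortable G
  sortable-by-join wf p0 smaller (c , fewer) = sortable-after (exchange p0 split) fewer (smaller fewer (wellFormed-exchange split wf))
    where open SafeCut c

  -- Apart from {0,1}, vertex 1 has a single end, taken by the adjacency {1,2}; so {1,m+1} is no edge.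
  second-cut-avoids-1 : ∀ {G R′ rest : Genome n} {p a mp z tp y m} → WellFormed G → G ≅ ((p , a) ∷ (mp , z) ∷ R′) →
                        toℕ p ≡ 0 → toℕ a ≡ 1 → 2 ≤ m → m ≤ n → toℕ z ≢ suc m → 1 ≤ adj 1 G →
                        ((a , z) ∷ R′) ≅ ((tp , y) ∷ rest) → toℕ tp ≡ suc m → toℕ y ≢ 1
  second-cut-avoids-1 {G} {R′} {rest} {p} {a} {mp} {z} {tp} {y} {m} wf split p0 a1 2≤m m≤n z≢ has1 rejoin tp≡ y1 =
    contradiction (begin
      2                              ≤⟨ +-mono-≤ (subst (1 ≤_) (adj-drop0 G K p a split p0 ≤-refl) has1) far-edge ⟩
      adj 1 K + ∑ jump K             ≡⟨ sym (∑-+ (isAdj 1) jump K) ⟩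
      ∑ (λ e → isAdj 1 e + jump e) K ≤⟨ ∑-mono K (λ e _ → joins+joins≤ends {1} e 2≢1+m) ⟩
      deg 1 K                        ≡⟨ deg1K ⟩
      1                              ∎) λ { (s≤s ()) }
    where
    open ≤-Reasoning
    K : Genome n
    K = (mp , z) ∷ R′
    jump : Edge n → ℕ
    jump = joins 1 (suc m)
    2≢1+m : 2 ≢ suc m
    2≢1+m 2≡ = contradiction (subst (2 ≤_) (suc-injective (sym 2≡)) 2≤m) λ { (s≤s ()) }
    1≢1+m : 1 ≢ suc m
    1≢1+m 1≡ = contradiction (subst (2 ≤_) (sym (suc-injective 1≡)) 2≤m) λ ()
    deg1K : deg 1 K ≡ 1
    deg1K = suc-injective (trans (sym (deg-rest G K p a split a1 λ p1 → 1+n≢0 (trans (sym p1) p0)))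
                                 (WellFormed.deg-inner wf 1 ≤-refl (≤-trans (s≤s z≤n) (≤-trans 2≤m m≤n))))
    jump-az : jump (a , z) ≡ 0
    jump-az = ¬1≤⇒≡0 (λ pos → case (joins-inv {1} {suc m} a z pos))
      where
      case : (toℕ a ≡ 1 × toℕ z ≡ suc m) ⊎ (toℕ a ≡ suc m × toℕ z ≡ 1) → ⊥
      case (inj₁ (_ , z≡))  = z≢ z≡
      case (inj₂ (a≡ , _)) = 1≢1+m (trans (sym a1) a≡)
    far-edge : 1 ≤ ∑ jump K
    far-edge = ≤-trans (begin
      1                        ≡⟨ sym (joins-≡1 tp y 1≢1+m (inj₂ (tp≡ , y1))) ⟩
      jump (tp , y)            ≤⟨ m≤m+n _ _ ⟩
      ∑ jump ((tp , y) ∷ rest) ≡⟨ sym (∑-≅ (joins-unoriented 1 (suc m)) {(a , z) ∷ R′} {(tp , y) ∷ rest} rejoin) ⟩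
      jump (a , z) + ∑ jump R′ ≡⟨ cong (_+ ∑ jump R′) jump-az ⟩
      ∑ jump R′                ∎) (m≤n+m _ (jump (mp , z)))

  sortable-two-steps : ∀ {G R : Genome n} {p a j} → WellFormed G → SortableBelow G → G ≅ ((p , a) ∷ R) →
                       toℕ p ≡ 0 → toℕ a ≡ 1 → FirstMissing G (suc (suc j)) → Sortable G
  sortable-two-steps {G} {R} {p} {a} {j} wf smaller split p0 a1 (_ , m≤n , noM , below) =
    after-cut (safe-cut-at wf split p0 a≢m (upper (suc j)) m≤n noM)
    where
    m : ℕ
    m = suc (suc j)
    a≢m : ∀ {k} → toℕ a ≢ suc (suc k)
    a≢m a≡ = 1+n≢0 (suc-injective (trans (sym a≡) a1))

    after-cut : SafeCut G p a m → Sortable G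
    after-cut (safe-cut mp z rest mp≡m split₁ keeps₁) =
      after-join (join {H₁} {(a , z) ∷ rest} wf₁ ↭-refl p0 (lower m) mp≡m (s≤s z≤n) m≤n noM₁)
      where
      flipped : G ≅ ((p , a) ∷ (z , mp) ∷ rest)
      flipped = ≅-trans {H = (p , a) ∷ (mp , z) ∷ rest} split₁ (≅-∷ refl (≅-∷ (sym (norm-swap (mp , z))) ↭-refl))
      H₁ : Genome n
      H₁ = (p , mp) ∷ (a , z) ∷ rest
      wf₁ : WellFormed H₁
      wf₁ = wellFormed-exchange flipped wf
      noM-cut : isAdj m (mp , z) ≡ 0 × adj m rest ≡ 0
      noM-cut = adj-tail ((mp , z) ∷ rest) rest (mp , z) ↭-refl (proj₂ (adj-tail G ((mp , z) ∷ rest) (p , a) split₁ noM))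
      noM₁ : adj m H₁ ≡ 0
      noM₁ = begin
        isAdj m (p , mp) + (isAdj m (a , z) + adj m rest) ≡⟨ cong (_+ (isAdj m (a , z) + adj m rest)) (isAdj-from0 {m} p mp p0 (s≤s z≤n)) ⟩
        isAdj m (a , z) + adj m rest                       ≡⟨ cong (_+ adj m rest) (joins-≡0 {m} {suc m} a z a≢m a≢m) ⟩
        adj m rest                                         ≡⟨ proj₂ noM-cut ⟩
        0                                                  ∎
        where open ≡-Reasoning
      z≢1+m : toℕ z ≢ suc m
      z≢1+m z≡ = 1+n≢0 (trans (sym (joins-≡1 mp z (1+n≢n ∘ sym) (inj₁ (mp≡m , z≡)))) (proj₁ noM-cut))

      after-join : Σ[ c ∈ SafeCut H₁ p mp (suc m) ] missing (SafeCut.joined c) < missing H₁ → Sortable G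
      after-join (safe-cut tp y rest₂ tp≡ split₂ _ , fewer₂) =
        sortable-after₂ (exchange p0 flipped) (exchange p0 split₂) fewer (absent-adjacent split p0 a1) (cong absent no01)
                        (smaller fewer wf₂)
        where
        H₂ : Genome n
        H₂ = (p , y) ∷ (mp , tp) ∷ rest₂
        wf₂ : WellFormed H₂
        wf₂ = wellFormed-exchange split₂ wf₁
        fewer : missing H₂ < missing G
        fewer = <-≤-trans fewer₂ (missing-mono {G} {H₁} (keeps-∷ (p , mp) (keeps-∷ (a , z) keeps₁)))
        no01 : adj 0 H₂ ≡ 0
        no01 = no-zero-adjacency {H₂} {(mp , tp) ∷ rest₂} wf₂ ↭-refl p0
                 (second-cut-avoids-1 {G} {rest} {rest₂} wf split₁ p0 a1 (s≤s (s≤s z≤n)) m≤n z≢1+m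
                                 (below 1 ≤-refl (s≤s (s≤s z≤n))) (drop-∷ split₂) tp≡)

  sortable-adjacent : ∀ {G R : Genome n} {p a} → WellFormed G → SortableBelow G → G ≅ ((p , a) ∷ R) →
                      toℕ p ≡ 0 → toℕ a ≡ 1 → Sortable G
  sortable-adjacent {G} {R} wf smaller split p0 a1 = by-first (complete-or-firstMissing G)
    where
    by-first : Complete G ⊎ ∃[ m ] FirstMissing G m → Sortable G
    by-first (inj₁ complete) =
      0 , done (identity-of-complete wf split p0 a1 complete) , subst (_≤ 3 * missing G) (sym (absent-adjacent split p0 a1)) z≤n
    by-first (inj₂ (1 , _ , 1≤n , no1 , _)) =
      sortable-by-join wf p0 smaller (join {G} {R} wf split p0 (lower 1) a1 ≤-refl 1≤n no1)
    by-first (inj₂ (suc (suc j) , first)) = sortable-two-steps wf smaller split p0 a1 first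

  sortable-last : ∀ {G R : Genome n} {p a} → WellFormed G → SortableBelow G → G ≅ ((p , a) ∷ R) →
                  toℕ p ≡ 0 → toℕ a ≡ suc n → 2 ≤ toℕ a → Sortable G
  sortable-last {G} {R} {p} {a} wf smaller split p0 a≡last 2≤a =
    sortable-by-join wf p0 smaller (join {G} {R} wf split p0 (proj₁ F) (trans a≡last (sym (proj₂ F))) 1≤n ≤-refl noN)
    where
    2≤1+n : 2 ≤ suc n
    2≤1+n = subst (2 ≤_) a≡last 2≤a
    1≤n : 1 ≤ n
    1≤n = ≤-pred 2≤1+n
    F : Σ[ F ∈ Flank n n (pred n) ] far F ≡ suc n
    F = upper-below 2≤1+n
    deg-R : deg (suc n) R ≡ 0
    deg-R = suc-injective (trans (sym (deg-rest G R p a split a≡last λ p≡ → 1+n≢0 (trans (sym p≡) p0))) (WellFormed.deg-last wf))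
    noN : adj n G ≡ 0
    noN = trans (adj-drop0 G R p a split p0 1≤n) (adj-absent R (inj₂ refl) deg-R)

  sortable-inner : ∀ {G R : Genome n} {p a} → WellFormed G → SortableBelow G → G ≅ ((p , a) ∷ R) →
                   toℕ p ≡ 0 → 2 ≤ toℕ a → toℕ a ≤ n → Sortable G
  sortable-inner {G} {R} {p} {a} wf smaller split p0 2≤a a≤n =
    from-other (edge-at (toℕ a) R (ends-unoriented (toℕ a)) (λ _ → ≤-refl) (≤-reflexive (sym deg-R)))
    where
    1≤a : 1 ≤ toℕ a
    1≤a = ≤-trans (s≤s z≤n) 2≤a
    deg-R : deg (toℕ a) R ≡ 1
    deg-R = suc-injective (trans (sym (deg-rest G R p a split refl λ p≡ → contradiction (subst (1 ≤_) (trans (sym p≡) p0) 1≤a) λ ()))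
                                 (WellFormed.deg-inner wf (toℕ a) 1≤a a≤n))

    from-other : EdgeAt (ends (toℕ a)) (toℕ a) R → Sortable G
    from-other (ap , zz , R₁ , ap≡a , split₁ , ends≥1) = by-direction (toℕ zz ≟ suc (toℕ a))
      where
      deg-R₁ : deg (toℕ a) R₁ ≡ 0
      deg-R₁ = n≤0⇒n≡0 (≤-pred (≤-trans (+-monoˡ-≤ (deg (toℕ a) R₁) ends≥1)
                                          (≤-reflexive (trans (sym (deg-≅ (toℕ a) R _ split₁)) deg-R))))
      absent-at : ∀ {s} → 1 ≤ s → toℕ a ≡ s ⊎ toℕ a ≡ suc s → isAdj s (ap , zz) ≡ 0 → adj s G ≡ 0
      absent-at {s} 1≤s a≡ other = begin
        adj s G                      ≡⟨ adj-drop0 G R p a split p0 1≤s ⟩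
        adj s R                      ≡⟨ adj-≅ s R _ split₁ ⟩
        isAdj s (ap , zz) + adj s R₁ ≡⟨ cong₂ _+_ other (adj-absent R₁ a≡ deg-R₁) ⟩
        0                            ∎
        where open ≡-Reasoning

      by-direction : Dec (toℕ zz ≡ suc (toℕ a)) → Sortable G
      by-direction (yes zz≡) =
        sortable-by-join wf p0 smaller (join {G} {R} wf split p0 (proj₁ F) (sym (proj₂ F)) 1≤s s≤n (absent-at 1≤s a≡ other))
        where
        F : Σ[ F ∈ Flank (pred (toℕ a)) (pred (toℕ a)) (pred (pred (toℕ a))) ] far F ≡ toℕ a
        F = upper-below 2≤a
        1≤s : 1 ≤ pred (toℕ a)
        1≤s = pred-mono-≤ 2≤a
        s≤n : pred (toℕ a) ≤ n
        s≤n = ≤-trans pred[n]≤n a≤n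
        a≡1+s : toℕ a ≡ suc (pred (toℕ a))
        a≡1+s = sym (suc-pred (toℕ a) {{>-nonZero 1≤a}})
        a≡ : toℕ a ≡ pred (toℕ a) ⊎ toℕ a ≡ suc (pred (toℕ a))
        a≡ = inj₂ a≡1+s
        other : isAdj (pred (toℕ a)) (ap , zz) ≡ 0
        other = ¬1≤⇒≡0 λ pos → 1+n≢n (sym (trans (isAdj-index-unique (ap , zz) pos isAdj-a) a≡1+s))
          where
          isAdj-a : 1 ≤ isAdj (toℕ a) (ap , zz)
          isAdj-a = ≤-reflexive (sym (joins-≡1 ap zz (1+n≢n ∘ sym) (inj₁ (ap≡a , zz≡))))
      by-direction (no zz≢) =
        sortable-by-join wf p0 smaller (join {G} {R} wf split p0 (lower (toℕ a)) refl 1≤a a≤n (absent-at 1≤a (inj₁ refl) other))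
        where
        other : isAdj (toℕ a) (ap , zz) ≡ 0
        other = ¬1≤⇒≡0 λ pos → case (isAdj-at ap zz ap≡a pos)
          where
          case : (toℕ a ≡ toℕ a × toℕ zz ≡ suc (toℕ a)) ⊎ (suc (toℕ a) ≡ toℕ a × toℕ zz ≡ toℕ a) → ⊥
          case (inj₁ (_ , zz≡))  = zz≢ zz≡
          case (inj₂ (eq , _))   = 1+n≢n eq

  sortable-step : ∀ G → SortableBelow G → WellFormed G → Sortable G
  sortable-step G smaller wf =
    from-zero-edge (edge-at 0 G (ends-unoriented 0) (λ _ → ≤-refl) (≤-reflexive (sym (WellFormed.deg-first wf))))
    where
    from-zero-edge : EdgeAt (ends 0) 0 G → Sortable G
    from-zero-edge (p , a , R , p0 , split , _) = by-end (toℕ a ≟ 1) (toℕ a ≟ suc n)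
      where
      a≢0 : toℕ a ≢ 0
      a≢0 a0 = contradiction (begin
        2                      ≡⟨ cong suc (sym (cong (δ 0) a0)) ⟩
        suc (δ 0 (toℕ a))      ≡⟨ sym (ends-at p a p0) ⟩
        ends 0 (p , a)         ≤⟨ m≤m+n _ (deg 0 R) ⟩
        deg 0 ((p , a) ∷ R)    ≡⟨ sym (deg-≅ 0 G _ split) ⟩
        deg 0 G                ≡⟨ WellFormed.deg-first wf ⟩
        1                      ∎) λ { (s≤s ()) }
        where open ≤-Reasoning
      by-end : Dec (toℕ a ≡ 1) → Dec (toℕ a ≡ suc n) → Sortable G
      by-end (yes a1)  _            = sortable-adjacent wf smaller split p0 a1
      by-end (no  a≢1) (yes a-last) = sortable-last wf smaller split p0 a-last (≢0∧≢1⇒≥2 a≢0 a≢1)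
      by-end (no  a≢1) (no  a≢last) =
        sortable-inner wf smaller split p0 (≢0∧≢1⇒≥2 a≢0 a≢1) (≤-pred (≤∧≢⇒< (vertex≤ a) a≢last))

  sortable : ∀ G → WellFormed G → Sortable G
  sortable = All.wfRec (On.wellFounded missing <-wellFounded) 0ℓ (λ G → WellFormed G → Sortable G) sortable-step

  pathEdge : (Vertex n → Vertex n) → Fin (suc n) → Edge n
  pathEdge f i = (f (inject₁ i) , f (fsuc i))

  δ-hit : ∀ {v} (x : Vertex n) → toℕ x ≡ v → δ v (toℕ x) ≡ 1
  δ-hit {v} x refl = δ-refl v

  δ-miss : ∀ {m} (g : Fin m → Vertex n) → (∀ {l l′} → g l ≡ g l′ → l ≡ l′) → ∀ {v j} → toℕ (g j) ≡ v →
           ∀ l → l ≢ j → δ v (toℕ (g l)) ≡ 0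
  δ-miss g g-inj gj≡v l l≢j = δ-≢ λ v≡gl → l≢j (g-inj (Fin.toℕ-injective (trans (sym v≡gl) (sym gj≡v))))

  wellFormed-path : ∀ (f : Vertex n → Vertex n) → (∀ {i j} → f i ≡ f j → i ≡ j) →
                    f fzero ≡ v0 → f (fromℕ (suc n)) ≡ vLast → WellFormed (tabulate (pathEdge f))
  wellFormed-path f f-inj f0 fl = record
    { size      = length-tabulate (pathEdge f)
    ; deg-first = trans (deg-split 0) (cong₂ _+_ (starts fzero (cong toℕ f0)) (no-ends not-first))
    ; deg-last  = trans (deg-split (suc n)) (cong₂ _+_ (no-starts not-last) (stops (fromℕ n) last-value))
    ; deg-inner = λ v 1≤v v≤n → trans (deg-split v) (passes v 1≤v v≤n)
    }
    where
    P : Genome n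
    P = tabulate (pathEdge f)
    firsts seconds : ℕ → Edge n → ℕ
    firsts  v e = δ v (toℕ (proj₁ e))
    seconds v e = δ v (toℕ (proj₂ e))
    deg-split : ∀ v → deg v P ≡ ∑ (firsts v) P + ∑ (seconds v) P
    deg-split v = ∑-+ (firsts v) (seconds v) P

    f∘inject₁-inj : ∀ {l l′} → f (inject₁ l) ≡ f (inject₁ l′) → l ≡ l′
    f∘inject₁-inj = Fin.inject₁-injective ∘ f-inj
    f∘fsuc-inj : ∀ {l l′} → f (fsuc l) ≡ f (fsuc l′) → l ≡ l′
    f∘fsuc-inj = Fin.suc-injective ∘ f-inj

    starts : ∀ {v} j → toℕ (f (inject₁ j)) ≡ v → ∑ (firsts v) P ≡ 1
    starts j hit = ∑-tabulate-1 _ (pathEdge f) j (δ-hit _ hit) (δ-miss (f ∘ inject₁) f∘inject₁-inj hit)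
    stops : ∀ {v} j → toℕ (f (fsuc j)) ≡ v → ∑ (seconds v) P ≡ 1
    stops j hit = ∑-tabulate-1 _ (pathEdge f) j (δ-hit _ hit) (δ-miss (f ∘ fsuc) f∘fsuc-inj hit)
    no-starts : ∀ {v} → (∀ l → toℕ (f (inject₁ l)) ≢ v) → ∑ (firsts v) P ≡ 0
    no-starts miss = ∑-tabulate-0 _ (pathEdge f) λ l → δ-≢ (miss l ∘ sym)
    no-ends : ∀ {v} → (∀ l → toℕ (f (fsuc l)) ≢ v) → ∑ (seconds v) P ≡ 0
    no-ends miss = ∑-tabulate-0 _ (pathEdge f) λ l → δ-≢ (miss l ∘ sym)

    not-first : ∀ l → toℕ (f (fsuc l)) ≢ 0
    not-first l eq = contradiction (f-inj (Fin.toℕ-injective (trans eq (sym (cong toℕ f0))))) λ ()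
    last-value : toℕ (f (fromℕ (suc n))) ≡ suc n
    last-value = trans (cong toℕ fl) (Fin.toℕ-fromℕ (suc n))
    not-last : ∀ l → toℕ (f (inject₁ l)) ≢ suc n
    not-last l eq = Fin.toℕ-inject₁-≢ l (sym (trans (cong toℕ (f-inj (Fin.toℕ-injective (trans eq (sym last-value)))))
                                                   (Fin.toℕ-fromℕ (suc n))))

    passes : ∀ v → 1 ≤ v → v ≤ n → ∑ (firsts v) P + ∑ (seconds v) P ≡ 2
    passes v 1≤v v≤n = at (injective⇒surjective f f-inj (fromℕ< (s≤s (m≤n⇒m≤1+n v≤n))))
      where
      at : ∃[ j ] f j ≡ fromℕ< (s≤s (m≤n⇒m≤1+n v≤n)) → ∑ (firsts v) P + ∑ (seconds v) P ≡ 2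
      at (j , fj≡) = cong₂ _+_ (starts (lower₁ j j≢last) (trans (cong (toℕ ∘ f) (Fin.inject₁-lower₁ j j≢last)) value))
                               (second j value)
        where
        value : toℕ (f j) ≡ v
        value = trans (cong toℕ fj≡) (Fin.toℕ-fromℕ< _)
        j≢last : suc n ≢ toℕ j
        j≢last eq = 1+n≰n (subst (_≤ n) (trans (sym value) (trans (cong (toℕ ∘ f) j≡last) last-value)) v≤n)
          where
          j≡last : j ≡ fromℕ (suc n)
          j≡last = Fin.toℕ-injective (trans (sym eq) (sym (Fin.toℕ-fromℕ (suc n))))
        second : ∀ j → toℕ (f j) ≡ v → ∑ (seconds v) P ≡ 1
        second fzero    f0≡v = contradiction (subst (1 ≤_) (trans (sym f0≡v) (cong toℕ f0)) 1≤v) λ ()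
        second (fsuc j) hit  = stops j hit

  linear⇒wellFormed : ∀ {G : Genome n} → IsLinear G → WellFormed G
  linear⇒wellFormed {G} (f , f-inj , f0 , fl , G≅) =
    wellFormed-transport (length-≅ G (tabulate (pathEdge f)) G≅P) (λ v → deg-≅ v G _ G≅P) (wellFormed-path f f-inj f0 fl)
    where
    G≅P : G ≅ tabulate (pathEdge f)
    G≅P = subst (G ≅_) (map-tabulate (λ i → i) (pathEdge f)) G≅

  -- Breakpoints

  sameEdge-sound : ∀ (e f : Edge n) → sameEdge e f ≡ true → norm e ≡ norm f
  sameEdge-sound e f same = pair-≡ (≡ᵇ-sound _ _ (proj₁ (∧-true same))) (≡ᵇ-sound _ _ (proj₂ (∧-true same)))

  sameEdge-complete : ∀ (e f : Edge n) → norm e ≡ norm f → sameEdge e f ≡ true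
  sameEdge-complete e f eq =
    subst (λ g → (toℕ (proj₁ g) ≡ᵇ toℕ (proj₁ (norm f))) ∧ (toℕ (proj₂ g) ≡ᵇ toℕ (proj₂ (norm f))) ≡ true) (sym eq)
          (cong₂ _∧_ (≡ᵇ-refl (toℕ (proj₁ (norm f)))) (≡ᵇ-refl (toℕ (proj₂ (norm f)))))

  sameEdge-adjacency : ∀ {i} (e f : Edge n) → 1 ≤ isAdj i e → fromBool (sameEdge e f) ≡ isAdj i f
  sameEdge-adjacency {i} e f adjacency with sameEdge e f in same
  ... | true  = sym (trans (unoriented-≡ (joins-unoriented i (suc i)) (sym (sameEdge-sound e f same))) (isAdj-≡1 e adjacency))
  ... | false = sym (¬1≤⇒≡0 λ adjacency′ →
                       contradiction (trans (sym (sameEdge-complete e f (isAdj-norm e f adjacency adjacency′))) same) λ ())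

  multiplicity-adjacency : ∀ {i} (G : Genome n) e → 1 ≤ isAdj i e → multiplicity G e ≡ adj i G
  multiplicity-adjacency G e adjacency = trans (count≡∑ (sameEdge e) G) (∑-cong (λ f → sameEdge-adjacency e f adjacency) G)

  lone : Genome n → Edge n → ℕ
  lone G e = ∑ (λ i → isAdj i e * single (adj i G)) inner

  ∑-lone : ∀ (G : Genome n) → ∑ (lone G) G + missing G ≤ n
  ∑-lone G = begin
    ∑ (lone G) G + missing G
      ≡⟨ cong (_+ missing G) (∑-comm (λ e i → isAdj i e * single (adj i G)) G inner) ⟩
    ∑ (λ i → ∑ (λ e → isAdj i e * single (adj i G)) G) inner + missing G
      ≡⟨ cong (_+ missing G) (∑-cong (λ i → ∑-*ʳ (isAdj i) _ G) inner) ⟩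
    ∑ (λ i → adj i G * single (adj i G)) inner + missing G               ≡⟨ sym (∑-+ _ _ inner) ⟩
    ∑ (λ i → adj i G * single (adj i G) + absent (adj i G)) inner        ≤⟨ ∑-mono inner (λ i _ → single+absent≤1 (adj i G)) ⟩
    ∑ (λ _ → 1) inner                                                    ≡⟨ ∑-const inner ⟩
    length inner                                                         ≡⟨ length-applyUpTo suc n ⟩
    n                                                                    ∎
    where open ≤-Reasoning

  adjacency-accounted : ∀ {G : Genome n} → WellFormed G → ∀ {e i} → e ∈ G → 1 ≤ i → i ≤ n → 1 ≤ isAdj i e →
                        1 ≤ fromBool (multiplicity G e ≡ᵇ 2) + lone G e
  adjacency-accounted {G} wf {e} {i} e∈ 1≤i i≤n adjacency
    rewrite multiplicity-adjacency G e adjacency = by-count (adj i G) refl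
    where
    present : 1 ≤ adj i G
    present = ≤-trans adjacency (∑-∈ (isAdj i) e∈)
    at-most-2 : adj i G ≤ 2
    at-most-2 = ≤-trans (∑-mono G (λ f _ → joins≤ends′ i (suc i) f)) (deg≤2 wf (s≤s z≤n) (s≤s i≤n))
    lone≥1 : adj i G ≡ 1 → 1 ≤ lone G e
    lone≥1 one = ≤-trans (≤-reflexive (sym (cong₂ _*_ (isAdj-≡1 e adjacency) (cong single one))))
                         (∑-∈ (λ j → isAdj j e * single (adj j G)) (∈-inner⁺ 1≤i i≤n))
    by-count : ∀ c → adj i G ≡ c → 1 ≤ fromBool (c ≡ᵇ 2) + lone G e
    by-count 0                   eq = contradiction (subst (1 ≤_) eq present) λ ()
    by-count 1                   eq = lone≥1 eq
    by-count 2                   _  = s≤s z≤n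
    by-count (suc (suc (suc _))) eq = contradiction (subst (_≤ 2) eq at-most-2) λ { (s≤s (s≤s ())) }

  inner-edge-accounted : ∀ {G : Genome n} → WellFormed G → ∀ {x y} → (x , y) ∈ G → toℕ x ≢ 0 → toℕ y ≢ 0 →
                         1 ≤ fromBool (isBreakpoint G (x , y)) + lone G (x , y)
  inner-edge-accounted {G} wf {x} {y} e∈ x≢0 y≢0 =
    subst (λ bp → 1 ≤ fromBool bp + lone G (x , y)) (sym breakpoint≡) (by-distance _ refl)
    where
    breakpoint≡ : isBreakpoint G (x , y) ≡ (not (∣ toℕ x - toℕ y ∣ ≡ᵇ 1) ∨ (multiplicity G (x , y) ≡ᵇ 2))
    breakpoint≡ = cong₂ (λ u w → not u ∧ not w ∧ (not (∣ toℕ x - toℕ y ∣ ≡ᵇ 1) ∨ (multiplicity G (x , y) ≡ᵇ 2)))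
                        (≢0⇒≡ᵇ0 x≢0) (≢0⇒≡ᵇ0 y≢0)
    by-side : toℕ y ≡ suc (toℕ x) ⊎ toℕ x ≡ suc (toℕ y) → 1 ≤ fromBool (multiplicity G (x , y) ≡ᵇ 2) + lone G (x , y)
    by-side (inj₁ y≡) = adjacency-accounted wf e∈ (n≢0⇒n>0 x≢0) (≤-pred (subst (_≤ suc n) y≡ (vertex≤ y)))
                          (≤-reflexive (sym (joins-≡1 x y (1+n≢n ∘ sym) (inj₁ (refl , y≡)))))
    by-side (inj₂ x≡) = adjacency-accounted wf e∈ (n≢0⇒n>0 y≢0) (≤-pred (subst (_≤ suc n) x≡ (vertex≤ x)))
                          (≤-reflexive (sym (joins-≡1 x y (1+n≢n ∘ sym) (inj₂ (x≡ , refl)))))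
    by-distance : ∀ d → (∣ toℕ x - toℕ y ∣ ≡ᵇ 1) ≡ d →
                  1 ≤ fromBool (not d ∨ (multiplicity G (x , y) ≡ᵇ 2)) + lone G (x , y)
    by-distance false _    = s≤s z≤n
    by-distance true  dist = by-side (∣-∣≡1 (toℕ x) (toℕ y) (≡ᵇ-sound _ _ dist))

  edge-accounted : ∀ {G : Genome n} → WellFormed G → ∀ e → e ∈ G → 1 ≤ ends 0 e + (fromBool (isBreakpoint G e) + lone G e)
  edge-accounted {G} wf (x , y) e∈ = by-zero (toℕ x ≟ 0) (toℕ y ≟ 0)
    where
    by-zero : Dec (toℕ x ≡ 0) → Dec (toℕ y ≡ 0) → 1 ≤ ends 0 (x , y) + (fromBool (isBreakpoint G (x , y)) + lone G (x , y))
    by-zero (yes x0) _        = ≤-trans (subst (1 ≤_) (sym (ends-at x y x0)) (s≤s z≤n)) (m≤m+n _ _)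
    by-zero (no _)   (yes y0) =
      ≤-trans (subst (1 ≤_) (sym (trans (ends-unoriented 0 (y , x)) (ends-at y x y0))) (s≤s z≤n)) (m≤m+n _ _)
    by-zero (no x≢0) (no y≢0) = ≤-trans (inner-edge-accounted wf e∈ x≢0 y≢0) (m≤n+m _ (ends 0 (x , y)))

  missing≤breakpoints : ∀ {G : Genome n} → WellFormed G → missing G ≤ b G
  missing≤breakpoints {G} wf = +-cancelˡ-≤ n (missing G) (b G) (begin
    n + missing G                    ≤⟨ +-monoˡ-≤ (missing G) edges ⟩
    b G + ∑ (lone G) G + missing G   ≡⟨ +-assoc (b G) _ _ ⟩
    b G + (∑ (lone G) G + missing G) ≤⟨ +-monoʳ-≤ (b G) (∑-lone G) ⟩
    b G + n                          ≡⟨ +-comm (b G) n ⟩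
    n + b G                          ∎)
    where
    open ≤-Reasoning
    edges : n ≤ b G + ∑ (lone G) G
    edges = ≤-pred (begin
      suc n                                                            ≡⟨ sym (WellFormed.size wf) ⟩
      length G                                                         ≡⟨ sym (∑-const G) ⟩
      ∑ (λ _ → 1) G                                                    ≤⟨ ∑-mono G (edge-accounted wf) ⟩
      ∑ (λ e → ends 0 e + (fromBool (isBreakpoint G e) + lone G e)) G  ≡⟨ ∑-+ (ends 0) _ G ⟩
      deg 0 G + ∑ (λ e → fromBool (isBreakpoint G e) + lone G e) G     ≡⟨ cong₂ _+_ (WellFormed.deg-first wf) (∑-+ _ (lone G) G) ⟩
      1 + (∑ (fromBool ∘ isBreakpoint G) G + ∑ (lone G) G)
        ≡⟨ cong (λ x → 1 + (x + ∑ (lone G) G)) (sym (count≡∑ (isBreakpoint G) G)) ⟩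
      suc (b G + ∑ (lone G) G)                                         ∎)

lemma4 : (n : ℕ) (G : Genome n) → IsLinear G →
    ∃[ k ] (ReachesIdentity k G × 2 * k ≤ 3 * b G)
lemma4 n G linear = within-budget (sortable G wf)
  where
  open Sorting n
  wf : WellFormed G
  wf = linear⇒wellFormed linear
  within-budget : Sortable G → ∃[ k ] (ReachesIdentity k G × 2 * k ≤ 3 * b G)
  within-budget (k , reaches , bound) = k , reaches , (begin
    2 * k                    ≤⟨ m≤m+n (2 * k) _ ⟩
    2 * k + absent (adj 0 G) ≤⟨ bound ⟩
    3 * missing G            ≤⟨ *-monoʳ-≤ 3 (missing≤breakpoints wf) ⟩
    3 * b G                  ∎)
    where open ≤-Reasoning
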